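{- Let $N$ be a positive integer, $\boldsymbol{k}=(k_1,\dots,k_r)$ an index with $r>1$, $\boldsymbol{x}=(x_1,\dots,x_r)$ indeterminates, and $1<i\le r$. When $k_{i-1}>1$ and $k_i>1$, \[ \frac{\Delta^{(N)}\widetilde{\mathrm{Li}}_{\boldsymbol{k}}^{\sqcup\!\sqcup,(N)}(\boldsymbol{x})}{\Delta^{(N)}x_i} = \frac{1}{x_i}\left(\widetilde{\mathrm{Li}}^{\sqcup\!\sqcup,(N)}_{\boldsymbol{k}^{\downarrow}_{i-1}}(\boldsymbol{x})\bigg|_{x_i+N^{ -1}}-\widetilde{\mathrm{Li}}^{\sqcup\!\sqcup,(N)}_{\boldsymbol{k}^{\downarrow}_i}(\boldsymbol{x})\right); \] when $k_{i-1}>1$ and $k_i=1$, \begin{align*} \frac{\Delta^{(N)} \widetilde{\mathrm{Li}}_{\boldsymbol{k}}^{\sqcup\!\sqcup,(N)}(\boldsymbol{x})}{\Delta^{(N)} x_i} &= \frac{1}{x_i}\left(\widetilde{\mathrm{Li}}_{\boldsymbol{k}_{i-1}^\downarrow}^{\sqcup\!\sqcup,(N)}(\boldsymbol{x})\bigg|_{x_i+N^{ -1}}+\widetilde{\mathrm{Li}}_{\boldsymbol{k}_i^\wedge}^{\sqcup\!\sqcup,(N)}(\boldsymbol{x}_i^\wedge)\right)\\ &\quad-\frac{1}{x_i+N^{ -1}-x_{i+1}}\left(\widetilde{\mathrm{Li}}_{\boldsymbol{k}_i^\wedge}^{\sqcup\!\sqcup,(N)}(\boldsymbol{x}_i^\wedge)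 - \widetilde{\mathrm{Li}}_{\boldsymbol{k}_i^\wedge}^{\sqcup\!\sqcup,(N)}(\boldsymbol{x}_{i+1}^\wedge)\bigg|_{x_i+N^{ -1}}\right)\\ &\quad-\frac{1}{N}\frac{1}{x_i(x_i+N^{ -1}-x_{i+1})}\left(\widetilde{\mathrm{Li}}_{(\boldsymbol{k}_{i-1}^\downarrow)_i^\wedge}^{\sqcup\!\sqcup,(N)}(\boldsymbol{x}_{i+1}^\wedge)\bigg|_{x_i+N^{ -1}} - \widetilde{\mathrm{Li}}_{(\boldsymbol{k}_{i-1}^\downarrow)_i^\wedge}^{\sqcup\!\sqcup,(N)}(\boldsymbol{x}_i^\wedge)\right); \end{align*} when $k_{i-1}=1$ and $k_i>1$, \begin{align*} \frac{\Delta^{(N)}\widetilde{\mathrm{Li}}_{\boldsymbol{k}}^{\sqcup\!\sqcup,(N)}(\boldsymbol{x})}{\Delta^{(N)}x_i}&=-\frac{1}{x_i-x_{i-1}} \left(\widetilde{\mathrm{Li}}_{\boldsymbol{k}_{i-1}^\wedge}^{\sqcup\!\sqcup,(N)}(\boldsymbol{x}_{i-1}^\wedge) - \widetilde{\mathrm{Li}}_{\boldsymbol{k}_{i-1}^\wedge}^{\sqcup\!\sqcup,(N)}(\boldsymbol{x}_i^\wedge) \right) - \frac{1}{x_i} \left(\widetilde{\mathrm{Li}}_{\boldsymbol{k}_{i-1}^\wedge}^{\sqcup\!\sqcup,(N)}(\boldsymbol{x}_i^\wedge) + \widetilde{\mathrm{Li}}_{\boldsymbol{k}_i^\downarrow}^{\sqcup\!\sqcup,(N)}(\boldsymbol{x})\right)\\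 &\quad-\frac{1}{N}\frac{1}{x_i(x_i-x_{i-1})}\left(\widetilde{\mathrm{Li}}_{(\boldsymbol{k}^{\downarrow}_i)^{\wedge}_{i-1}}^{\sqcup\!\sqcup,(N)}(\boldsymbol{x}^{\wedge}_i)-\widetilde{\mathrm{Li}}_{(\boldsymbol{k}^{\downarrow}_i)^{\wedge}_{i-1}}^{\sqcup\!\sqcup,(N)}(\boldsymbol{x}^{\wedge}_{i-1})\right); \end{align*} when $k_{i-1}=k_i=1$, \begin{align*} \frac{\Delta^{(N)} \widetilde{\mathrm{Li}}_{\boldsymbol{k}}^{\sqcup\!\sqcup,(N)}(\boldsymbol{x})}{\Delta^{(N)} x_i} &= -\frac{1}{x_i - x_{i-1}} \left(\widetilde{\mathrm{Li}}_{\boldsymbol{k}_{i-1}^\wedge}^{\sqcup\!\sqcup,(N)}(\boldsymbol{x}_{i-1}^\wedge) - \widetilde{\mathrm{Li}}_{\boldsymbol{k}_i^\wedge}^{\sqcup\!\sqcup,(N)} (\boldsymbol{x}_i^\wedge)\right) \\ &\quad- \frac{1}{x_i+N^{ -1}-x_{i+1}} \left(\widetilde{\mathrm{Li}}_{\boldsymbol{k}_i^\wedge}^{\sqcup\!\sqcup,(N)}(\boldsymbol{x}_i^\wedge) - \widetilde{\mathrm{Li}}_{\boldsymbol{k}_i^\wedge}^{\sqcup\!\sqcup,(N)} (\boldsymbol{x}_{i+1}^\wedge)\bigg|_{x_i+N^{ -1}} \right). \end{align*} For the case $i=r$, interpret $x_{r+1}=1$ and $\widetilde{\mathrm{Li}}_{\boldsymbol{k}_r^\wedge}^{\sqcup\!\sqcup,(N)}(\boldsymbol{x}_{r+1}^\wedge)\big|_{x_r+N^{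 -1}} = \widetilde{\mathrm{Li}}_{(\boldsymbol{k}_{r-1}^\downarrow)_r^\wedge}^{\sqcup\!\sqcup,(N)}(\boldsymbol{x}_{r+1}^\wedge)\big|_{x_r+N^{ -1}}=0$.
   Context: Here $\sqcup\!\sqcup$ denotes the shuffle symbol. With $x_{r+1}\coloneqq1$, \[ \widetilde{\mathrm{Li}}_{\boldsymbol{k}}^{\sqcup\!\sqcup,(N)}(\boldsymbol{x})\coloneqq\sum_{0<n_1<\cdots<n_r<N}\frac{1}{n_1^{k_1}\cdots n_r^{k_r}}\prod_{i=1}^{r}\frac{\binom{Nx_{i+1}-1}{n_i}}{\binom{Nx_i-1}{n_i}}. \] The difference quotient is $\frac{\Delta^{(N)}f(\boldsymbol{x})}{\Delta^{(N)}x_i}\coloneqq N\bigl(f(x_1,\dots,x_i+N^{ -1},\dots,x_r)-f(\boldsymbol{x})\bigr)$, and $f(\boldsymbol{x})\big|_{x_i+N^{ -1}}$ means $f$ evaluated with $x_i$ replaced by $x_i+N^{ -1}$. Notation: $\boldsymbol{k}^{\wedge}_i$ removes the $i$-th entry of $\boldsymbol{k}$; $\boldsymbol{k}^{\downarrow}_i$ replaces $k_i$ by $k_i-1$ (for $k_i>1$); $\boldsymbol{x}^{\wedge}_i$ removes the $i$-th entry of $\boldsymbol{x}$; compositions such as $(\boldsymbol{k}_{i-1}^\downarrow)_i^\wedge$ apply these operations successively. -}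

module Defs where

open import Data.Nat as ℕ using (ℕ; zero; suc; _<ᵇ_)
open import Data.Integer using (+_)
open import Data.Rational using (ℚ; 0ℚ; 1ℚ; _+_; _*_; _-_; -_; 1/_; _/_; ≢-nonZero)
import Data.Rational.Properties as ℚP
open import Data.List using (List; []; _∷_; length)
open import Data.Bool using (if_then_else_)
open import Relation.Nullary using (yes; no)

ℕ→ℚ : ℕ → ℚ
ℕ→ℚ n = + n / 1

-- total division on ℚ (value 0 when dividing by 0; all uses in the
-- statement carry hypotheses making the denominators nonzero)
infixl 7 _÷_
_÷_ : ℚ → ℚ → ℚ
p ÷ q with q ℚP.≟ 0ℚ
... | yes _ = 0ℚ
... | no q≢0 = p * (1/_ q {{≢-nonZero q≢0}})

_^_ : ℚ → ℕ → ℚ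
p ^ zero = 1ℚ
p ^ suc k = p * (p ^ k)

Σ< : ℕ → (ℕ → ℚ) → ℚ
Σ< zero f = 0ℚ
Σ< (suc m) f = Σ< m f + f m

Π< : ℕ → (ℕ → ℚ) → ℚ
Π< zero f = 1ℚ
Π< (suc m) f = Π< m f * f m

factorialℚ : ℕ → ℚ
factorialℚ n = Π< n (λ j → ℕ→ℚ (suc j))

binom : ℚ → ℕ → ℚ
binom a n = Π< n (λ j → a - ℕ→ℚ j) ÷ factorialℚ n

-- 1-based list operations
-- nth d xs j : the j-th entry (1-based), d if out of range
nth : {A : Set} → A → List A → ℕ → A
nth d [] j = d
nth d (x ∷ xs) zero = d
nth d (x ∷ xs) (suc zero) = x
nth d (x ∷ xs) (suc (suc j)) = nth d xs (suc j)

del : {A : Set} → List A → ℕ → List A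
del [] j = []
del (x ∷ xs) zero = x ∷ xs
del (x ∷ xs) (suc zero) = xs
del (x ∷ xs) (suc (suc j)) = x ∷ del xs (suc j)

upd : {A : Set} → (A → A) → List A → ℕ → List A
upd f [] j = []
upd f (x ∷ xs) zero = x ∷ xs
upd f (x ∷ xs) (suc zero) = f x ∷ xs
upd f (x ∷ xs) (suc (suc j)) = x ∷ upd f xs (suc j)

dec : List ℕ → ℕ → List ℕ
dec k j = upd ℕ.pred k j

shift : ℕ → List ℚ → ℕ → List ℚ
shift N x j = upd (λ t → t + (1ℚ ÷ ℕ→ℚ N)) x j

-- head with default 1 (implements x_{r+1} := 1)
head1 : List ℚ → ℚ
head1 [] = 1ℚ
head1 (y ∷ ys) = y

-- LiFrom N a k x = Σ_{a < n_1 < ... < n_r < N} Π_i n_i^{-k_i}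
--                    binom(N x_{i+1} - 1, n_i) / binom(N x_i - 1, n_i)
-- with x_{r+1} := 1.
LiFrom : ℕ → ℕ → List ℕ → List ℚ → ℚ
LiFrom N a [] [] = 1ℚ
LiFrom N a [] (_ ∷ _) = 0ℚ
LiFrom N a (_ ∷ _) [] = 0ℚ
LiFrom N a (k ∷ ks) (x ∷ xs) =
  Σ< N (λ n → if a <ᵇ n
     then ((1ℚ ÷ (ℕ→ℚ n ^ k))
            * (binom (ℕ→ℚ N * head1 xs - 1ℚ) n ÷ binom (ℕ→ℚ N * x - 1ℚ) n)
            * LiFrom N n ks xs)
     else 0ℚ)

Li : ℕ → List ℕ → List ℚ → ℚ
Li N k x = LiFrom N 0 k x

ΔLi : ℕ → List ℕ → List ℚ → ℕ → ℚ
ΔLi N k x i = ℕ→ℚ N * (Li N k (shift N x i) - Li N k x)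

-- \widetilde{Li}_{κ}(x^∧_{i+1})|_{x_i+N^{-1}}, with the convention that it
-- is 0 when i = r (= length x)
LiNext : ℕ → List ℕ → List ℚ → ℕ → ℚ
LiNext N κ x i = if i <ᵇ length x then Li N κ (shift N (del x (suc i)) i) else 0ℚ

{-# OPTIONS --safe #-}
-- Scale the truncated sum by the binomial at its lower bound:
-- W a k x = binom(N x₁ - 1, a) · LiFrom N a k x.  Then
--   W a (k ∷ κ) (x ∷ y) = B_x(a) Σ_{a<n<N} n^{-k} B_x(n)^{-1} W n κ y,   B_x(n) = binom(N x - 1, n),
-- so each variable only enters through ratios B_x(a)/B_x(n), and each index only through the
-- weight n^{-k}.  Replacing x by x + 1/N multiplies such a ratio by (N x - n)/(N x - a), and
-- multiplying the summand by n lowers k by one; together these express the difference quotient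
-- in x_i through the sums with k_{i-1} or k_i lowered by one.  When an index reaches 0 the
-- inner sum of ratios binom(N z - 1, m)/binom(N v - 1, m) telescopes, which removes that variable
-- and produces the terms without x_{i-1} or x_{i+1}.  Solving the resulting linear relations
-- gives the four cases.  All of this happens inside the sums over n_{i-1} and n_i, so the
-- identities, proved for i = 2, hold for every i.
module Submission where

open import Defs
open import Data.Nat using (ℕ; zero; suc; pred; _<_; _≤_; _>_; _<ᵇ_; z≤n; s≤s)
import Data.Nat.Properties as ℕₚ
import Data.Integer as ℤ
open import Data.Integer using (1ℤ)
import Data.Integer.Tactic.RingSolver as ℤ-Solver
open import Data.Rational using (ℚ; 0ℚ; 1ℚ; _+_; _*_; _-_; -_; toℚᵘ; ≢-nonZero)
open import Data.Rational.Properties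
  using ( _≟_; +-*-commutativeRing; +-0-group; *-identityˡ; *-identityʳ; *-zeroˡ; *-zeroʳ
        ; *-assoc; *-comm; *-distribˡ-+; *-inverseʳ; +-identityʳ; 1≢0; <-irrefl; positive⁻¹
        ; normalize-pos; toℚᵘ-injective; toℚᵘ-fromℚᵘ; toℚᵘ-homo-+ )
import Data.Rational.Unnormalised as ᵘ
import Data.Rational.Unnormalised.Properties as ᵘ
open import Algebra.Properties.Group +-0-group
  using () renaming (x∙y⁻¹≈ε⇒x≈y to p-q≡0⇒p≡q; x≈y⇒x∙y⁻¹≈ε to p≡q⇒p-q≡0)
open import Data.List using (List; []; _∷_; length; map)
open import Data.List.Relation.Unary.All using (All)
open import Data.Bool using (Bool; true; false; if_then_else_; T)
open import Data.Product using (_×_; _,_)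
open import Data.Sum using (_⊎_; inj₁; inj₂; [_,_]′)
open import Data.Empty using (⊥-elim)
open import Data.Unit using (tt)
open import Level using (0ℓ)
open import Relation.Nullary.Decidable using (Dec; yes; no; dec⇒maybe)
open import Relation.Binary.PropositionalEquality
import Tactic.RingSolver.Core.AlmostCommutativeRing as ACR
open import Tactic.RingSolver using (solve-∀)

ringℚ : ACR.AlmostCommutativeRing 0ℓ 0ℓ
ringℚ = ACR.fromCommutativeRing +-*-commutativeRing (λ q → dec⇒maybe (0ℚ ≟ q))

ℕ→ℚ-suc : ∀ n → ℕ→ℚ (suc n) ≡ ℕ→ℚ n + 1ℚ
ℕ→ℚ-suc n = toℚᵘ-injective (begin
    toℚᵘ (ℕ→ℚ (suc n))         ≈⟨ toℚᵘ-fromℚᵘ (ᵘ.mkℚᵘ (ℤ.+ suc n) 0) ⟩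
    ᵘ.mkℚᵘ (ℤ.+ suc n) 0        ≈⟨ ᵘ.*≡* (suc-as-sum (ℤ.+ n)) ⟩
    ᵘ.mkℚᵘ (ℤ.+ n) 0 ᵘ.+ ᵘ.1ℚᵘ  ≈⟨ ᵘ.+-congˡ ᵘ.1ℚᵘ (toℚᵘ-fromℚᵘ (ᵘ.mkℚᵘ (ℤ.+ n) 0)) ⟨
    toℚᵘ (ℕ→ℚ n) ᵘ.+ toℚᵘ 1ℚ    ≈⟨ toℚᵘ-homo-+ (ℕ→ℚ n) 1ℚ ⟨
    toℚᵘ (ℕ→ℚ n + 1ℚ)          ∎)
  where
  open ᵘ.≃-Reasoning
  suc-as-sum : ∀ m → (1ℤ ℤ.+ m) ℤ.* 1ℤ ≡ (m ℤ.* 1ℤ ℤ.+ 1ℤ ℤ.* 1ℤ) ℤ.* 1ℤ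
  suc-as-sum = ℤ-Solver.solve-∀

ℕ→ℚ-suc-≢0 : ∀ n → ℕ→ℚ (suc n) ≢ 0ℚ
ℕ→ℚ-suc-≢0 n eq = <-irrefl (sym eq) (positive⁻¹ (ℕ→ℚ (suc n)) {{normalize-pos (suc n) 1}})

p-q≢0 : ∀ {p q} → p ≢ q → p - q ≢ 0ℚ
p-q≢0 {p} {q} p≢q p-q≡0 = p≢q (p-q≡0⇒p≡q p q p-q≡0)

p÷q≡p*[1÷q] : ∀ p q → p ÷ q ≡ p * (1ℚ ÷ q)
p÷q≡p*[1÷q] p q with q ≟ 0ℚ
... | yes _ = sym (*-zeroʳ p)
... | no _  = cong (p *_) (sym (*-identityˡ _))

÷-inverseʳ : ∀ {q} → q ≢ 0ℚ → q * (1ℚ ÷ q) ≡ 1ℚ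
÷-inverseʳ {q} q≢0 with q ≟ 0ℚ
... | yes q≡0 = ⊥-elim (q≢0 q≡0)
... | no q≢0  = trans (cong (q *_) (*-identityˡ _)) (*-inverseʳ q {{≢-nonZero q≢0}})

*-1÷-cancelʳ : ∀ p {q} → q ≢ 0ℚ → p * (1ℚ ÷ q) * q ≡ p
*-1÷-cancelʳ p {q} q≢0 = begin
  p * (1ℚ ÷ q) * q    ≡⟨ *-assoc p _ q ⟩
  p * ((1ℚ ÷ q) * q)  ≡⟨ cong (p *_) (trans (*-comm _ q) (÷-inverseʳ q≢0)) ⟩
  p * 1ℚ              ≡⟨ *-identityʳ p ⟩
  p                   ∎
  where open ≡-Reasoning

*-cancelʳ-≡ : ∀ {p q} r → r ≢ 0ℚ → p * r ≡ q * r → p ≡ q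
*-cancelʳ-≡ {p} {q} r r≢0 pr≡qr = begin
  p                   ≡⟨ *-1÷-cancelʳ p r≢0 ⟨
  p * (1ℚ ÷ r) * r    ≡⟨ swap p ⟩
  p * r * (1ℚ ÷ r)    ≡⟨ cong (_* (1ℚ ÷ r)) pr≡qr ⟩
  q * r * (1ℚ ÷ r)    ≡⟨ swap q ⟨
  q * (1ℚ ÷ r) * r    ≡⟨ *-1÷-cancelʳ q r≢0 ⟩
  q                   ∎
  where
  open ≡-Reasoning
  swap : ∀ s → s * (1ℚ ÷ r) * r ≡ s * r * (1ℚ ÷ r)
  swap s = trans (*-assoc s _ r) (trans (cong (s *_) (*-comm _ r)) (sym (*-assoc s r _)))

*-≢0 : ∀ {p q} → p ≢ 0ℚ → q ≢ 0ℚ → p * q ≢ 0ℚ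
*-≢0 {p} {q} p≢0 q≢0 pq≡0 = p≢0 (*-cancelʳ-≡ q q≢0 (trans pq≡0 (sym (*-zeroˡ q))))

1÷-*-distrib : ∀ p q → 1ℚ ÷ (p * q) ≡ (1ℚ ÷ p) * (1ℚ ÷ q)
1÷-*-distrib p q = by-cases (p ≟ 0ℚ) (q ≟ 0ℚ)
  where
  open ≡-Reasoning
  regroup : ∀ p q p′ q′ → p * p′ * (q * q′) ≡ p′ * q′ * (p * q)
  regroup = solve-∀ ringℚ
  by-cases : Dec (p ≡ 0ℚ) → Dec (q ≡ 0ℚ) → 1ℚ ÷ (p * q) ≡ (1ℚ ÷ p) * (1ℚ ÷ q)
  by-cases (yes refl) _ = trans (cong (1ℚ ÷_) (*-zeroˡ q)) (sym (*-zeroˡ (1ℚ ÷ q)))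
  by-cases (no _) (yes refl) = trans (cong (1ℚ ÷_) (*-zeroʳ p)) (sym (*-zeroʳ (1ℚ ÷ p)))
  by-cases (no p≢0) (no q≢0) = *-cancelʳ-≡ (p * q) (*-≢0 p≢0 q≢0) (begin
    1ℚ ÷ (p * q) * (p * q)          ≡⟨ trans (*-comm _ (p * q)) (÷-inverseʳ (*-≢0 p≢0 q≢0)) ⟩
    1ℚ                              ≡⟨ cong₂ _*_ (÷-inverseʳ p≢0) (÷-inverseʳ q≢0) ⟨
    p * (1ℚ ÷ p) * (q * (1ℚ ÷ q))   ≡⟨ regroup p q (1ℚ ÷ p) (1ℚ ÷ q) ⟩
    (1ℚ ÷ p) * (1ℚ ÷ q) * (p * q)   ∎)

÷-cross : ∀ {p q} r s → p ≢ 0ℚ → q ≢ 0ℚ → r * q ≡ s * p → r * (1ℚ ÷ p) ≡ s * (1ℚ ÷ q)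
÷-cross {p} {q} r s p≢0 q≢0 rq≡sp = *-cancelʳ-≡ (p * q) (*-≢0 p≢0 q≢0) (begin
  r * (1ℚ ÷ p) * (p * q)      ≡⟨ regroup r p q (1ℚ ÷ p) ⟩
  r * q * (p * (1ℚ ÷ p))      ≡⟨ cong₂ _*_ rq≡sp (÷-inverseʳ p≢0) ⟩
  s * p * 1ℚ                  ≡⟨ cong (s * p *_) (÷-inverseʳ q≢0) ⟨
  s * p * (q * (1ℚ ÷ q))      ≡⟨ regroup′ s p q (1ℚ ÷ q) ⟨
  s * (1ℚ ÷ q) * (p * q)      ∎)
  where
  open ≡-Reasoning
  regroup : ∀ r p q p′ → r * p′ * (p * q) ≡ r * q * (p * p′)
  regroup = solve-∀ ringℚ
  regroup′ : ∀ s p q q′ → s * q′ * (p * q) ≡ s * p * (q * q′)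
  regroup′ = solve-∀ ringℚ

-- An equation that holds modulo hypotheses pᵢ ≡ qᵢ is proved from a ring
-- identity  lhs = rhs + Σ αᵢ (pᵢ - qᵢ)  whose residual vanishes term by term.
modulo : ∀ {lhs rhs residual} → lhs ≡ rhs + residual → residual ≡ 0ℚ → lhs ≡ rhs
modulo {rhs = rhs} eq refl = trans eq (+-identityʳ rhs)

vanish : ∀ {p q} α → p ≡ q → α * (p - q) ≡ 0ℚ
vanish α p≡q = trans (cong (α *_) (p≡q⇒p-q≡0 p≡q)) (*-zeroʳ α)

infixr 5 _+₀_
_+₀_ : ∀ {e₁ e₂} → e₁ ≡ 0ℚ → e₂ ≡ 0ℚ → e₁ + e₂ ≡ 0ℚ
refl +₀ refl = refl

falling : ℚ → ℕ → ℚ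
falling A n = Π< n (λ j → A - ℕ→ℚ j)

factorialℚ-≢0 : ∀ n → factorialℚ n ≢ 0ℚ
factorialℚ-≢0 zero    = 1≢0
factorialℚ-≢0 (suc n) = *-≢0 (factorialℚ-≢0 n) (ℕ→ℚ-suc-≢0 n)

binom-*-factorial : ∀ A n → binom A n * factorialℚ n ≡ falling A n
binom-*-factorial A n =
  trans (cong (_* factorialℚ n) (p÷q≡p*[1÷q] (falling A n) (factorialℚ n)))
        (*-1÷-cancelʳ (falling A n) (factorialℚ-≢0 n))

*-factorialℚ-cancelʳ : ∀ n {p q} → p * factorialℚ n ≡ q * factorialℚ n → p ≡ q
*-factorialℚ-cancelʳ n = *-cancelʳ-≡ (factorialℚ n) (factorialℚ-≢0 n)

binom-suc : ∀ A n → binom A (suc n) * ℕ→ℚ (suc n) ≡ binom A n * (A - ℕ→ℚ n)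
binom-suc A n = *-factorialℚ-cancelʳ n (begin
  binom A (suc n) * m * n!            ≡⟨ rotate (binom A (suc n)) m n! ⟩
  binom A (suc n) * (n! * m)          ≡⟨ binom-*-factorial A (suc n) ⟩
  falling A n * (A - ℕ→ℚ n)           ≡⟨ cong (_* (A - ℕ→ℚ n)) (binom-*-factorial A n) ⟨
  binom A n * n! * (A - ℕ→ℚ n)        ≡⟨ rotate′ (binom A n) n! (A - ℕ→ℚ n) ⟩
  binom A n * (A - ℕ→ℚ n) * n!        ∎)
  where
  open ≡-Reasoning
  m = ℕ→ℚ (suc n)
  n! = factorialℚ n
  rotate : ∀ b m f → b * m * f ≡ b * (f * m)
  rotate = solve-∀ ringℚ
  rotate′ : ∀ b f c → b * f * c ≡ b * c * f
  rotate′ = solve-∀ ringℚ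

falling-+1 : ∀ A n → falling (A + 1ℚ) n * ((A + 1ℚ) - ℕ→ℚ n) ≡ (A + 1ℚ) * falling A n
falling-+1 A zero = base A
  where
  base : ∀ A → 1ℚ * ((A + 1ℚ) - 0ℚ) ≡ (A + 1ℚ) * 1ℚ
  base = solve-∀ ringℚ
falling-+1 A (suc n) = begin
  falling (A + 1ℚ) n * ((A + 1ℚ) - ℕ→ℚ n) * ((A + 1ℚ) - ℕ→ℚ (suc n))
    ≡⟨ cong₂ _*_ (falling-+1 A n) (cong (λ t → (A + 1ℚ) - t) (ℕ→ℚ-suc n)) ⟩
  (A + 1ℚ) * falling A n * ((A + 1ℚ) - (ℕ→ℚ n + 1ℚ))
    ≡⟨ step A (falling A n) (ℕ→ℚ n) ⟩
  (A + 1ℚ) * (falling A n * (A - ℕ→ℚ n))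
    ∎
  where
  open ≡-Reasoning
  step : ∀ A P m → (A + 1ℚ) * P * ((A + 1ℚ) - (m + 1ℚ)) ≡ (A + 1ℚ) * (P * (A - m))
  step = solve-∀ ringℚ

binom-+1 : ∀ A n → binom (A + 1ℚ) n * ((A + 1ℚ) - ℕ→ℚ n) ≡ (A + 1ℚ) * binom A n
binom-+1 A n = *-factorialℚ-cancelʳ n (begin
  binom (A + 1ℚ) n * ((A + 1ℚ) - ℕ→ℚ n) * n!   ≡⟨ swap (binom (A + 1ℚ) n) _ n! ⟩
  binom (A + 1ℚ) n * n! * ((A + 1ℚ) - ℕ→ℚ n)   ≡⟨ cong (_* ((A + 1ℚ) - ℕ→ℚ n)) (binom-*-factorial (A + 1ℚ) n) ⟩
  falling (A + 1ℚ) n * ((A + 1ℚ) - ℕ→ℚ n)      ≡⟨ falling-+1 A n ⟩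
  (A + 1ℚ) * falling A n                       ≡⟨ cong ((A + 1ℚ) *_) (binom-*-factorial A n) ⟨
  (A + 1ℚ) * (binom A n * n!)                  ≡⟨ *-assoc (A + 1ℚ) (binom A n) n! ⟨
  (A + 1ℚ) * binom A n * n!                    ∎)
  where
  open ≡-Reasoning
  n! = factorialℚ n
  swap : ∀ b c f → b * c * f ≡ b * f * c
  swap = solve-∀ ringℚ

falling-≢0 : ∀ A n → (∀ j → j < n → A ≢ ℕ→ℚ j) → falling A n ≢ 0ℚ
falling-≢0 A zero    _ = 1≢0
falling-≢0 A (suc n) A≢j =
  *-≢0 (falling-≢0 A n (λ j j<n → A≢j j (ℕₚ.m<n⇒m<1+n j<n))) (p-q≢0 (A≢j n ℕₚ.≤-refl))

binom-≢0 : ∀ A n → (∀ j → j < n → A ≢ ℕ→ℚ j) → binom A n ≢ 0ℚ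
binom-≢0 A n A≢j binom≡0 = falling-≢0 A n A≢j (begin
  falling A n                 ≡⟨ binom-*-factorial A n ⟨
  binom A n * factorialℚ n    ≡⟨ cong (_* factorialℚ n) binom≡0 ⟩
  0ℚ * factorialℚ n           ≡⟨ *-zeroˡ (factorialℚ n) ⟩
  0ℚ                          ∎)
  where open ≡-Reasoning

falling-≡0 : ∀ A n j → j < n → A ≡ ℕ→ℚ j → falling A n ≡ 0ℚ
falling-≡0 A (suc n) j j<1+n A≡j with ℕₚ.m<1+n⇒m<n∨m≡n j<1+n
... | inj₁ j<n  = trans (cong (_* (A - ℕ→ℚ n)) (falling-≡0 A n j j<n A≡j)) (*-zeroˡ (A - ℕ→ℚ n))
... | inj₂ refl = trans (cong (falling A n *_) (p≡q⇒p-q≡0 A≡j)) (*-zeroʳ (falling A n))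

binom-≡0 : ∀ A n j → j < n → A ≡ ℕ→ℚ j → binom A n ≡ 0ℚ
binom-≡0 A n j j<n A≡j = *-factorialℚ-cancelʳ n (begin
  binom A n * factorialℚ n    ≡⟨ binom-*-factorial A n ⟩
  falling A n                 ≡⟨ falling-≡0 A n j j<n A≡j ⟩
  0ℚ                          ≡⟨ *-zeroˡ (factorialℚ n) ⟨
  0ℚ * factorialℚ n           ∎)
  where open ≡-Reasoning

Σ<-cong : ∀ M {f g : ℕ → ℚ} → (∀ n → n < M → f n ≡ g n) → Σ< M f ≡ Σ< M g
Σ<-cong zero    _   = refl
Σ<-cong (suc M) f≡g =
  cong₂ _+_ (Σ<-cong M (λ n n<M → f≡g n (ℕₚ.m<n⇒m<1+n n<M))) (f≡g M ℕₚ.≤-refl)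

Σ<-+ : ∀ M (f g : ℕ → ℚ) → Σ< M (λ n → f n + g n) ≡ Σ< M f + Σ< M g
Σ<-+ zero    f g = refl
Σ<-+ (suc M) f g =
  trans (cong (_+ (f M + g M)) (Σ<-+ M f g)) (interchange (Σ< M f) (Σ< M g) (f M) (g M))
  where
  interchange : ∀ a b c d → a + b + (c + d) ≡ a + c + (b + d)
  interchange = solve-∀ ringℚ

*-Σ< : ∀ M c (f : ℕ → ℚ) → c * Σ< M f ≡ Σ< M (λ n → c * f n)
*-Σ< zero    c f = *-zeroʳ c
*-Σ< (suc M) c f = trans (*-distribˡ-+ c (Σ< M f) (f M)) (cong (_+ c * f M) (*-Σ< M c f))

-- Encoded exactly as the sums in LiFrom, so that LiFrom unfolds to Σ[ a < n < N ] definitionally.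
Σ-between : ℕ → ℕ → (ℕ → ℚ) → ℚ
Σ-between a M f = Σ< M (λ n → if a <ᵇ n then f n else 0ℚ)

syntax Σ-between a M (λ n → f) = Σ[ a < n < M ] f

if-true : ∀ {b : Bool} {x y : ℚ} → T b → (if b then x else y) ≡ x
if-true {true} _ = refl

Σ-cong : ∀ a M {f g : ℕ → ℚ} → (∀ n → a < n → n < M → f n ≡ g n) →
         Σ[ a < n < M ] f n ≡ Σ[ a < n < M ] g n
Σ-cong a M {f} {g} f≡g = Σ<-cong M (λ n n<M → pointwise n n<M (a <ᵇ n) refl)
  where
  pointwise : ∀ n → n < M → ∀ b → (a <ᵇ n) ≡ b →
              (if b then f n else 0ℚ) ≡ (if b then g n else 0ℚ)
  pointwise n n<M true  a<ᵇn = f≡g n (ℕₚ.<ᵇ⇒< a n (subst T (sym a<ᵇn) tt)) n<M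
  pointwise n n<M false _    = refl

Σ-+ : ∀ a M (f g : ℕ → ℚ) → Σ[ a < n < M ] (f n + g n) ≡ Σ[ a < n < M ] f n + Σ[ a < n < M ] g n
Σ-+ a M f g = trans (Σ<-cong M (λ n _ → if-+ (a <ᵇ n))) (Σ<-+ M _ _)
  where
  if-+ : ∀ {n} b → (if b then f n + g n else 0ℚ) ≡ (if b then f n else 0ℚ) + (if b then g n else 0ℚ)
  if-+ true  = refl
  if-+ false = refl

*-Σ : ∀ a M c (f : ℕ → ℚ) → c * Σ[ a < n < M ] f n ≡ Σ[ a < n < M ] (c * f n)
*-Σ a M c f = trans (*-Σ< M c _) (Σ<-cong M (λ n _ → *-if (a <ᵇ n)))
  where
  *-if : ∀ {n} b → c * (if b then f n else 0ℚ) ≡ (if b then c * f n else 0ℚ)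
  *-if true  = refl
  *-if false = *-zeroʳ c

Σ-lin : ∀ a M α β (f g : ℕ → ℚ) →
        Σ[ a < n < M ] (α * f n + β * g n) ≡ α * Σ[ a < n < M ] f n + β * Σ[ a < n < M ] g n
Σ-lin a M α β f g =
  trans (Σ-+ a M _ _) (sym (cong₂ _+_ (*-Σ a M α f) (*-Σ a M β g)))

Σ-empty : ∀ a M (f : ℕ → ℚ) → M ≤ suc a → Σ[ a < n < M ] f n ≡ 0ℚ
Σ-empty a zero    f _ = refl
Σ-empty a (suc M) f M≤a with a <ᵇ M in a<ᵇM
... | true  = ⊥-elim (ℕₚ.<⇒≱ (ℕₚ.<ᵇ⇒< a M (subst T (sym a<ᵇM) tt)) (ℕₚ.≤-pred M≤a))
... | false = trans (+-identityʳ _) (Σ-empty a M f (ℕₚ.m≤n⇒m≤1+n (ℕₚ.≤-pred M≤a)))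

if-Σ : ∀ a M (f : ℕ → ℚ) → (if a <ᵇ M then Σ[ a < n < M ] f n else 0ℚ) ≡ Σ[ a < n < M ] f n
if-Σ a M f with a <ᵇ M in a<ᵇM
... | true  = refl
... | false = sym (Σ-empty a M f (ℕₚ.m≤n⇒m≤1+n (ℕₚ.≮⇒≥ (λ a<M → subst T a<ᵇM (ℕₚ.<⇒<ᵇ a<M)))))

*-Σ-cong : ∀ a M {X Y} (f : ℕ → ℚ) → (suc a < M → X ≡ Y) →
           X * Σ[ a < n < M ] f n ≡ Y * Σ[ a < n < M ] f n
*-Σ-cong a M {X} {Y} f X≡Y = [ nonempty , empty ]′ (ℕₚ.<-≤-connex (suc a) M)
  where
  open ≡-Reasoning
  nonempty : suc a < M → X * Σ[ a < n < M ] f n ≡ Y * Σ[ a < n < M ] f n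
  nonempty 1+a<M = cong (_* Σ[ a < n < M ] f n) (X≡Y 1+a<M)
  empty : M ≤ suc a → X * Σ[ a < n < M ] f n ≡ Y * Σ[ a < n < M ] f n
  empty M≤1+a = begin
    X * Σ[ a < n < M ] f n   ≡⟨ cong (X *_) (Σ-empty a M f M≤1+a) ⟩
    X * 0ℚ                   ≡⟨ *-zeroʳ X ⟩
    0ℚ                       ≡⟨ *-zeroʳ Y ⟨
    Y * 0ℚ                   ≡⟨ cong (Y *_) (Σ-empty a M f M≤1+a) ⟨
    Y * Σ[ a < n < M ] f n   ∎

Σ-swap : ∀ a M (h : ℕ → ℕ → ℚ) →
         Σ[ a < m < M ] Σ[ m < n < M ] h m n ≡ Σ[ a < n < M ] Σ[ a < m < n ] h m n
Σ-swap a zero    h = refl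
Σ-swap a (suc M) h = begin
  Σ< M (λ m → if a <ᵇ m then Σ[ m < n < M ] h m n + (if m <ᵇ M then h m M else 0ℚ) else 0ℚ)
    + (if a <ᵇ M then Σ[ M < n < suc M ] h M n else 0ℚ)
      ≡⟨ cong₂ _+_ (Σ-+ a M _ _) (if-0 (a <ᵇ M) (Σ-empty M (suc M) (h M) ℕₚ.≤-refl)) ⟩
  Σ[ a < m < M ] Σ[ m < n < M ] h m n + Σ[ a < m < M ] (if m <ᵇ M then h m M else 0ℚ) + 0ℚ
      ≡⟨ +-identityʳ _ ⟩
  Σ[ a < m < M ] Σ[ m < n < M ] h m n + Σ[ a < m < M ] (if m <ᵇ M then h m M else 0ℚ)
      ≡⟨ cong₂ _+_ (Σ-swap a M h) (Σ-cong a M (λ m _ m<M → if-true (ℕₚ.<⇒<ᵇ m<M))) ⟩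
  Σ[ a < n < M ] Σ[ a < m < n ] h m n + Σ[ a < m < M ] h m M
      ≡⟨ cong (Σ[ a < n < M ] Σ[ a < m < n ] h m n +_) (if-Σ a M (λ m → h m M)) ⟨
  Σ[ a < n < suc M ] Σ[ a < m < n ] h m n
      ∎
  where
  open ≡-Reasoning
  if-0 : ∀ b {x} → x ≡ 0ℚ → (if b then x else 0ℚ) ≡ 0ℚ
  if-0 true  x≡0 = x≡0
  if-0 false _   = refl

Σ-telescope : ∀ a L (t F : ℕ → ℚ) → a < L → (∀ m → a < m → m < L → t m ≡ F (suc m) - F m) →
              Σ[ a < m < L ] t m ≡ F L - F (suc a)
Σ-telescope a (suc L) t F a<1+L step with ℕₚ.m<1+n⇒m<n∨m≡n a<1+L
... | inj₂ refl = trans (Σ-empty a (suc a) t ℕₚ.≤-refl) (sym (p≡q⇒p-q≡0 {F (suc a)} refl))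
... | inj₁ a<L  = begin
  Σ[ a < m < L ] t m + (if a <ᵇ L then t L else 0ℚ)
    ≡⟨ cong₂ _+_ (Σ-telescope a L t F a<L (λ m a<m m<L → step m a<m (ℕₚ.m<n⇒m<1+n m<L)))
                 (if-true (ℕₚ.<⇒<ᵇ a<L)) ⟩
  (F L - F (suc a)) + t L
    ≡⟨ cong ((F L - F (suc a)) +_) (step L a<L ℕₚ.≤-refl) ⟩
  (F L - F (suc a)) + (F (suc L) - F L)
    ≡⟨ collapse (F L) (F (suc a)) (F (suc L)) ⟩
  F (suc L) - F (suc a)
    ∎
  where
  open ≡-Reasoning
  collapse : ∀ x y z → (x - y) + (z - x) ≡ z - y
  collapse = solve-∀ ringℚ

-- In cases 2–4 the difference quotient contains a term P whose index at position i or i - 1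
-- is 0.  Summing out that variable gives P · K = Q with K = -N (x_i + 1/N - x_{i+1}) or
-- K = N (x_i - x_{i-1}); solving for P and substituting yields the right-hand sides.

÷-solve : ∀ P Q p q p⁻¹ q⁻¹ → P * (p * q) ≡ Q → p * p⁻¹ ≡ 1ℚ → q * q⁻¹ ≡ 1ℚ → P ≡ Q * (p⁻¹ * q⁻¹)
÷-solve P Q p q p⁻¹ q⁻¹ e p-inv q-inv =
  modulo (certificate P Q p q p⁻¹ q⁻¹)
         (vanish (p⁻¹ * q⁻¹) e +₀ vanish (- (P * q * q⁻¹)) p-inv +₀ vanish (- P) q-inv)
  where
  certificate : ∀ P Q p q i j →
    P ≡ Q * (i * j) + ((i * j) * (P * (p * q) - Q) + ((- (P * q * j)) * (p * i - 1ℚ) + (- P) * (q * j - 1ℚ)))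
  certificate = solve-∀ ringℚ

solve-P₀ : ∀ Nq δ xi z ic P0 Q →
  P0 * ((Nq * z - 1ℚ) - (Nq * xi - 1ℚ) - 1ℚ) ≡ Q → Nq * δ ≡ 1ℚ → (xi + δ - z) * ic ≡ 1ℚ →
  P0 ≡ Q * (δ * (- ic))
solve-P₀ Nq δ xi z ic P0 Q e Nqδ≡1 c-inv =
  ÷-solve P0 Q Nq (- (xi + δ - z)) δ (- ic) (trans (cong (P0 *_) (sym K≡)) e) Nqδ≡1 (trans (neg-inv (xi + δ - z) ic) c-inv)
  where
  certificate : ∀ n z x d → (n * z - 1ℚ) - (n * x - 1ℚ) - 1ℚ ≡ n * (- (x + d - z)) + 1ℚ * (n * d - 1ℚ)
  certificate = solve-∀ ringℚ
  K≡ : (Nq * z - 1ℚ) - (Nq * xi - 1ℚ) - 1ℚ ≡ Nq * (- (xi + δ - z))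
  K≡ = modulo (certificate Nq z xi δ) (vanish 1ℚ Nqδ≡1)
  neg-inv : ∀ c i → (- c) * (- i) ≡ c * i
  neg-inv = solve-∀ ringℚ

solve-P₁ : ∀ Nq δ xi xp id P1 Q →
  P1 * (((Nq * xi - 1ℚ) + 1ℚ) - (Nq * xp - 1ℚ) - 1ℚ) ≡ Q → Nq * δ ≡ 1ℚ → (xi - xp) * id ≡ 1ℚ →
  P1 ≡ Q * (δ * id)
solve-P₁ Nq δ xi xp id P1 Q e Nqδ≡1 d-inv =
  ÷-solve P1 Q Nq (xi - xp) δ id (trans (cong (P1 *_) (sym (K≡ Nq xi xp))) e) Nqδ≡1 d-inv
  where
  K≡ : ∀ n x p → ((n * x - 1ℚ) + 1ℚ) - (n * p - 1ℚ) - 1ℚ ≡ n * (x - p)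
  K≡ = solve-∀ ringℚ

combine₂ : ∀ Nq δ xi ix z ic icx P1 P0 L Ld D Dd →
  P0 * ((Nq * z - 1ℚ) - (Nq * xi - 1ℚ) - 1ℚ) ≡ (((Nq * xi - 1ℚ) + 1ℚ) * L - Ld) - ((Nq * z - 1ℚ) * D - Dd) →
  xi * ix ≡ 1ℚ → Nq * δ ≡ 1ℚ → (xi + δ - z) * ic ≡ 1ℚ → icx ≡ ix * ic →
  ix * (P1 - P0) ≡ ix * (P1 + D) - ic * (D - L) - δ * icx * (Ld - Dd)
combine₂ Nq δ xi ix z ic icx P1 P0 L Ld D Dd e x-inv Nqδ≡1 c-inv icx≡ =
  trans (cong (λ p → ix * (P1 - p)) (solve-P₀ Nq δ xi z ic P0 _ e Nqδ≡1 c-inv))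
    (modulo (certificate Nq δ xi ix z ic icx P1 L Ld D Dd)
      (vanish (ic * L * Nq * δ - ic * D) x-inv +₀ vanish (ic * L - D * ix * ic * z) Nqδ≡1
        +₀ vanish (D * ix) c-inv +₀ vanish (- (δ * (Dd - Ld))) icx≡))
  where
  certificate : ∀ Nq δ xi ix z ic icx P1 L Ld D Dd →
    ix * (P1 - ((((Nq * xi - 1ℚ) + 1ℚ) * L - Ld) - ((Nq * z - 1ℚ) * D - Dd)) * (δ * (- ic)))
      ≡ ix * (P1 + D) - ic * (D - L) - δ * icx * (Ld - Dd)
        + ((ic * L * Nq * δ - ic * D) * (xi * ix - 1ℚ)
          + ((ic * L - D * ix * ic * z) * (Nq * δ - 1ℚ)
          + ((D * ix) * ((xi + δ - z) * ic - 1ℚ)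
          + (- (δ * (Dd - Ld))) * (icx - ix * ic))))
  certificate = solve-∀ ringℚ

combine₃ : ∀ Nq δ xi ix xp id icp P1 P0 X Xd Yv Yd →
  P1 * (((Nq * xi - 1ℚ) + 1ℚ) - (Nq * xp - 1ℚ) - 1ℚ)
    ≡ (((Nq * xp - 1ℚ) + 1ℚ) * X - Xd) - (((Nq * xi - 1ℚ) + 1ℚ) * Yv - Yd) →
  xi * ix ≡ 1ℚ → Nq * δ ≡ 1ℚ → (xi - xp) * id ≡ 1ℚ → icp ≡ ix * id →
  ix * (P1 - P0) ≡ - id * (Yv - X) - ix * (X + P0) - δ * icp * (Xd - Yd)
combine₃ Nq δ xi ix xp id icp P1 P0 X Xd Yv Yd e x-inv Nqδ≡1 d-inv icp≡ =
  trans (cong (λ p → ix * (p - P0)) (solve-P₁ Nq δ xi xp id P1 _ e Nqδ≡1 d-inv))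
    (modulo (certificate Nq δ xi ix xp id icp P0 X Xd Yv Yd)
      (vanish (X * id - Yv * id * Nq * δ) x-inv +₀ vanish (X * ix * id * xp - Yv * id) Nqδ≡1
        +₀ vanish (- (X * ix)) d-inv +₀ vanish (- (δ * (Yd - Xd))) icp≡))
  where
  certificate : ∀ Nq δ xi ix xp id icp P0 X Xd Yv Yd →
    ix * (((((Nq * xp - 1ℚ) + 1ℚ) * X - Xd) - (((Nq * xi - 1ℚ) + 1ℚ) * Yv - Yd)) * (δ * id) - P0)
      ≡ - id * (Yv - X) - ix * (X + P0) - δ * icp * (Xd - Yd)
        + ((X * id - Yv * id * Nq * δ) * (xi * ix - 1ℚ)
          + ((X * ix * id * xp - Yv * id) * (Nq * δ - 1ℚ)
          + ((- (X * ix)) * ((xi - xp) * id - 1ℚ)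
          + (- (δ * (Yd - Xd))) * (icp - ix * id))))
  certificate = solve-∀ ringℚ

combine₄ : ∀ Nq δ xi ix xp z id ic P1 P0 Yv D L Yd Dd Ld →
  P0 * ((Nq * z - 1ℚ) - (Nq * xi - 1ℚ) - 1ℚ) ≡ (((Nq * xi - 1ℚ) + 1ℚ) * L - Ld) - ((Nq * z - 1ℚ) * D - Dd) →
  P1 * (((Nq * xi - 1ℚ) + 1ℚ) - (Nq * xp - 1ℚ) - 1ℚ)
    ≡ (((Nq * xp - 1ℚ) + 1ℚ) * D - Dd) - (((Nq * xi - 1ℚ) + 1ℚ) * Yv - Yd) →
  Yd * ((Nq * z - 1ℚ) - (Nq * xi - 1ℚ) - 1ℚ) - Dd * ((Nq * z - 1ℚ) - (Nq * xp - 1ℚ) - 1ℚ)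
    + Ld * (((Nq * xi - 1ℚ) + 1ℚ) - (Nq * xp - 1ℚ) - 1ℚ) ≡ 0ℚ →
  xi * ix ≡ 1ℚ → Nq * δ ≡ 1ℚ → (xi + δ - z) * ic ≡ 1ℚ → (xi - xp) * id ≡ 1ℚ →
  ix * (P1 - P0) ≡ - id * (Yv - D) - ic * (D - L)
combine₄ Nq δ xi ix xp z id ic P1 P0 Yv D L Yd Dd Ld
         e₂ e₃ cycle x-inv Nqδ≡1 c-inv d-inv =
  trans (cong₂ (λ p q → ix * (p - q)) (solve-P₁ Nq δ xi xp id P1 _ e₃ Nqδ≡1 d-inv) (solve-P₀ Nq δ xi z ic P0 _ e₂ Nqδ≡1 c-inv))
    (modulo (certificate Nq δ xi ix xp z id ic Yv D L Yd Dd Ld)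
      (vanish (- (id * Nq * δ * Yv) + ic * Nq * δ * L + D * (id - ic)) x-inv
        +₀ vanish (- (id * Yv) + ic * L + D * (ix * id * xp - ix * ic * z)) Nqδ≡1
        +₀ vanish (- (D * ix)) d-inv +₀ vanish (D * ix) c-inv +₀ vanish 1ℚ d-terms))
  where
  d-certificate : ∀ Nq δ xi ix xp z id ic Yd Dd Ld →
    ix * δ * (id * (Yd - Dd) + ic * (Dd - Ld))
      ≡ 0ℚ + ((- (ix * δ * δ * id * ic))
               * ((Yd * ((Nq * z - 1ℚ) - (Nq * xi - 1ℚ) - 1ℚ) - Dd * ((Nq * z - 1ℚ) - (Nq * xp - 1ℚ) - 1ℚ)
                   + Ld * (((Nq * xi - 1ℚ) + 1ℚ) - (Nq * xp - 1ℚ) - 1ℚ)) - 0ℚ)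
        + ((- (ix * δ * id * (Yd - Dd) * (xi + δ - z) * ic) - ix * δ * ic * (Dd - Ld) * (xi - xp) * id
             + ix * δ * δ * id * ic * (Yd - Dd)) * (Nq * δ - 1ℚ)
        + ((- (ix * δ * id * (Yd - Dd))) * ((xi + δ - z) * ic - 1ℚ)
        + (- (ix * δ * ic * (Dd - Ld))) * ((xi - xp) * id - 1ℚ))))
  d-certificate = solve-∀ ringℚ
  d-terms : ix * δ * (id * (Yd - Dd) + ic * (Dd - Ld)) ≡ 0ℚ
  d-terms = modulo (d-certificate Nq δ xi ix xp z id ic Yd Dd Ld)
    (vanish (- (ix * δ * δ * id * ic)) cycle
      +₀ vanish (- (ix * δ * id * (Yd - Dd) * (xi + δ - z) * ic) - ix * δ * ic * (Dd - Ld) * (xi - xp) * id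
                 + ix * δ * δ * id * ic * (Yd - Dd)) Nqδ≡1
      +₀ vanish (- (ix * δ * id * (Yd - Dd))) c-inv +₀ vanish (- (ix * δ * ic * (Dd - Ld))) d-inv)
  certificate : ∀ Nq δ xi ix xp z id ic Yv D L Yd Dd Ld →
    ix * (((((Nq * xp - 1ℚ) + 1ℚ) * D - Dd) - (((Nq * xi - 1ℚ) + 1ℚ) * Yv - Yd)) * (δ * id)
          - ((((Nq * xi - 1ℚ) + 1ℚ) * L - Ld) - ((Nq * z - 1ℚ) * D - Dd)) * (δ * (- ic)))
      ≡ - id * (Yv - D) - ic * (D - L)
        + (((- (id * Nq * δ * Yv)) + ic * Nq * δ * L + D * (id - ic)) * (xi * ix - 1ℚ)
        + (((- (id * Yv)) + ic * L + D * (ix * id * xp - ix * ic * z)) * (Nq * δ - 1ℚ)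
        + ((- (D * ix)) * ((xi - xp) * id - 1ℚ)
        + ((D * ix) * ((xi + δ - z) * ic - 1ℚ)
        + 1ℚ * (ix * δ * (id * (Yd - Dd) + ic * (Dd - Ld)) - 0ℚ)))))
  certificate = solve-∀ ringℚ

-- Formal linear combinations Σ cᵢ f κᵢ yᵢ, so that one right-hand side can be evaluated both
-- at W a (for every a) and at Li.  A term with flag false counts as 0; this encodes the
-- boundary terms that vanish for i = r.
record Term : Set where
  constructor term
  field
    coeff   : ℚ
    indices : List ℕ
    point   : List ℚ
    present : Bool

eval : (List ℕ → List ℚ → ℚ) → List Term → ℚ
eval f []                  = 0ℚ
eval f (term c κ y b ∷ ts) = c * (if b then f κ y else 0ℚ) + eval f ts

eval-cong : ∀ {f g : List ℕ → List ℚ → ℚ} → (∀ κ y → f κ y ≡ g κ y) → ∀ ts → eval f ts ≡ eval g ts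
eval-cong f≡g []                  = refl
eval-cong {f} {g} f≡g (term c κ y b ∷ ts) = cong₂ _+_ (cong (c *_) (if-cong b)) (eval-cong f≡g ts)
  where
  if-cong : ∀ b → (if b then f κ y else 0ℚ) ≡ (if b then g κ y else 0ℚ)
  if-cong true  = f≡g κ y
  if-cong false = refl

prefix : ℕ → ℚ → Term → Term
prefix k x (term c κ y b) = term c (k ∷ κ) (x ∷ y) b

Case₁ Case₂ Case₃ Case₄ : ℕ → ℕ → Set
Case₁ kp ki = kp > 1 × ki > 1
Case₂ kp ki = kp > 1 × ki ≡ 1
Case₃ kp ki = kp ≡ 1 × ki > 1
Case₄ kp ki = kp ≡ 1 × ki ≡ 1

module _ (N' : ℕ) where

  private
    N : ℕ
    N = suc N'

  Nq : ℚ
  Nq = ℕ→ℚ N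

  δ : ℚ
  δ = 1ℚ ÷ Nq

  -- A v = N v - 1 is the upper argument of the binomials attached to a variable v;
  -- the shift v ↦ v + 1/N raises it to V v = A v + 1.
  A V : ℚ → ℚ
  A v = Nq * v - 1ℚ
  V v = A v + 1ℚ

  B : ℚ → ℕ → ℚ
  B v n = binom (A v) n

  Nq*δ≡1 : Nq * δ ≡ 1ℚ
  Nq*δ≡1 = ÷-inverseʳ (ℕ→ℚ-suc-≢0 N')

  A-shift : ∀ v → A (v + δ) ≡ V v
  A-shift v = modulo (identity Nq v δ) (vanish 1ℚ Nq*δ≡1)
    where
    identity : ∀ n v d → n * (v + d) - 1ℚ ≡ (n * v - 1ℚ) + 1ℚ + 1ℚ * (n * d - 1ℚ)
    identity = solve-∀ ringℚ

  A-1 : A 1ℚ ≡ ℕ→ℚ N'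
  A-1 = trans (cong (λ q → q * 1ℚ - 1ℚ) (ℕ→ℚ-suc N')) (identity (ℕ→ℚ N'))
    where
    identity : ∀ m → (m + 1ℚ) * 1ℚ - 1ℚ ≡ m
    identity = solve-∀ ringℚ

  B-shift : ∀ v n → B (v + δ) n * (V v - ℕ→ℚ n) ≡ V v * B v n
  B-shift v n = trans (cong (λ u → binom u n * (V v - ℕ→ℚ n)) (A-shift v)) (binom-+1 (A v) n)

  Generic : ℚ → Set
  Generic v = ∀ m → m < N → Nq * v ≢ ℕ→ℚ m

  generic-≢0 : ∀ {v} → Generic v → v ≢ 0ℚ
  generic-≢0 Gv v≡0 = Gv 0 (s≤s z≤n) (trans (cong (Nq *_) v≡0) (*-zeroʳ Nq))

  private
    V≡Nq*v : ∀ v → V v ≡ Nq * v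
    V≡Nq*v v = identity Nq v
      where
      identity : ∀ n v → (n * v - 1ℚ) + 1ℚ ≡ n * v
      identity = solve-∀ ringℚ

  B-≢0 : ∀ {v} → Generic v → ∀ n → n < N → B v n ≢ 0ℚ
  B-≢0 {v} Gv n n<N = binom-≢0 (A v) n (λ j j<n A≡j →
    Gv (suc j) (ℕₚ.≤-<-trans j<n n<N)
       (trans (sym (V≡Nq*v v)) (trans (cong (_+ 1ℚ) A≡j) (sym (ℕ→ℚ-suc j)))))

  B-shift-≢0 : ∀ {v} → Generic v → ∀ n → n < N → B (v + δ) n ≢ 0ℚ
  B-shift-≢0 {v} Gv n n<N = binom-≢0 (A (v + δ)) n (λ j j<n A≡j →
    Gv j (ℕₚ.<-trans j<n n<N) (trans (sym (V≡Nq*v v)) (trans (sym (A-shift v)) A≡j)))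

  weight : ℕ → ℕ → ℚ
  weight k n = 1ℚ ÷ (ℕ→ℚ n ^ k)

  weight-pred : ∀ k n → 1 ≤ k → 1 ≤ n → weight k n * ℕ→ℚ n ≡ weight (pred k) n
  weight-pred (suc k) (suc n) _ _ = begin
    1ℚ ÷ (m * m ^ k) * m             ≡⟨ cong (_* m) (1÷-*-distrib m (m ^ k)) ⟩
    (1ℚ ÷ m) * (1ℚ ÷ m ^ k) * m      ≡⟨ regroup (1ℚ ÷ m) (1ℚ ÷ m ^ k) m ⟩
    (1ℚ ÷ m ^ k) * (m * (1ℚ ÷ m))    ≡⟨ cong ((1ℚ ÷ m ^ k) *_) (÷-inverseʳ (ℕ→ℚ-suc-≢0 n)) ⟩
    (1ℚ ÷ m ^ k) * 1ℚ                ≡⟨ *-identityʳ _ ⟩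
    1ℚ ÷ m ^ k                       ∎
    where
    open ≡-Reasoning
    m = ℕ→ℚ (suc n)
    regroup : ∀ i r m → i * r * m ≡ r * (m * i)
    regroup = solve-∀ ringℚ

  W : ℕ → List ℕ → List ℚ → ℚ
  W a κ y = B (head1 y) a * LiFrom N a κ y

  Li≡W0 : ∀ κ y → Li N κ y ≡ W 0 κ y
  Li≡W0 κ y = sym (*-identityˡ (LiFrom N 0 κ y))

  prepend : ℕ → ℚ → (ℕ → ℚ) → ℕ → ℚ
  prepend k x G a = B x a * Σ[ a < n < N ] (weight k n * (1ℚ ÷ B x n) * G n)

  W-∷ : ∀ a k κ x y → W a (k ∷ κ) (x ∷ y) ≡ prepend k x (λ n → W n κ y) a
  W-∷ a k κ x y = cong (B x a *_) (Σ-cong a N (λ n _ _ → summand n))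
    where
    regroup : ∀ w b i l → w * (b * i) * l ≡ w * i * (b * l)
    regroup = solve-∀ ringℚ
    summand : ∀ n → weight k n * (B (head1 y) n ÷ B x n) * LiFrom N n κ y
                  ≡ weight k n * (1ℚ ÷ B x n) * W n κ y
    summand n = trans (cong (λ r → weight k n * r * LiFrom N n κ y) (p÷q≡p*[1÷q] (B (head1 y) n) (B x n)))
                      (regroup (weight k n) (B (head1 y) n) (1ℚ ÷ B x n) (LiFrom N n κ y))

  prepend-cong : ∀ k x a {G H : ℕ → ℚ} → (∀ n → a < n → n < N → G n ≡ H n) →
                 prepend k x G a ≡ prepend k x H a
  prepend-cong k x a G≡H = cong (B x a *_) (Σ-cong a N (λ n a<n n<N →
    cong (weight k n * (1ℚ ÷ B x n) *_) (G≡H n a<n n<N)))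

  prepend-lin : ∀ k x a α β (G H : ℕ → ℚ) →
                prepend k x (λ n → α * G n + β * H n) a ≡ α * prepend k x G a + β * prepend k x H a
  prepend-lin k x a α β G H = begin
    B x a * Σ[ a < n < N ] (c n * (α * G n + β * H n))
      ≡⟨ cong (B x a *_) (Σ-cong a N (λ n _ _ → distrib (c n) α β (G n) (H n))) ⟩
    B x a * Σ[ a < n < N ] (α * (c n * G n) + β * (c n * H n))
      ≡⟨ cong (B x a *_) (Σ-lin a N α β _ _) ⟩
    B x a * (α * Σ[ a < n < N ] (c n * G n) + β * Σ[ a < n < N ] (c n * H n))
      ≡⟨ distrib′ (B x a) α β _ _ ⟩
    α * prepend k x G a + β * prepend k x H a
      ∎
    where
    open ≡-Reasoning
    c : ℕ → ℚ
    c n = weight k n * (1ℚ ÷ B x n)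
    distrib : ∀ c α β g h → c * (α * g + β * h) ≡ α * (c * g) + β * (c * h)
    distrib = solve-∀ ringℚ
    distrib′ : ∀ b α β s t → b * (α * s + β * t) ≡ α * (b * s) + β * (b * t)
    distrib′ = solve-∀ ringℚ

  prepend-* : ∀ k x a α (G : ℕ → ℚ) → prepend k x (λ n → α * G n) a ≡ α * prepend k x G a
  prepend-* k x a α G = begin
    prepend k x (λ n → α * G n) a                ≡⟨ prepend-cong k x a (λ n _ _ → pad α (G n)) ⟩
    prepend k x (λ n → α * G n + 0ℚ * G n) a     ≡⟨ prepend-lin k x a α 0ℚ G G ⟩
    α * prepend k x G a + 0ℚ * prepend k x G a   ≡⟨ pad α _ ⟨
    α * prepend k x G a                          ∎
    where
    open ≡-Reasoning
    pad : ∀ α g → α * g ≡ α * g + 0ℚ * g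
    pad = solve-∀ ringℚ

  prepend-*-− : ∀ k x a α (G H : ℕ → ℚ) →
                prepend k x (λ n → α * (G n - H n)) a ≡ α * (prepend k x G a - prepend k x H a)
  prepend-*-− k x a α G H = begin
    prepend k x (λ n → α * (G n - H n)) a          ≡⟨ prepend-cong k x a (λ n _ _ → split α (G n) (H n)) ⟩
    prepend k x (λ n → α * G n + (- α) * H n) a    ≡⟨ prepend-lin k x a α (- α) G H ⟩
    α * prepend k x G a + (- α) * prepend k x H a  ≡⟨ split α _ _ ⟨
    α * (prepend k x G a - prepend k x H a)        ∎
    where
    open ≡-Reasoning
    split : ∀ α g h → α * (g - h) ≡ α * g + (- α) * h
    split = solve-∀ ringℚ

  prepend-− : ∀ k x a (G H : ℕ → ℚ) →
              prepend k x (λ n → G n - H n) a ≡ prepend k x G a - prepend k x H a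
  prepend-− k x a G H = begin
    prepend k x (λ n → G n - H n) a            ≡⟨ prepend-cong k x a (λ n _ _ → *-identityˡ (G n - H n)) ⟨
    prepend k x (λ n → 1ℚ * (G n - H n)) a     ≡⟨ prepend-*-− k x a 1ℚ G H ⟩
    1ℚ * (prepend k x G a - prepend k x H a)   ≡⟨ *-identityˡ (prepend k x G a - prepend k x H a) ⟩
    prepend k x G a - prepend k x H a          ∎
    where open ≡-Reasoning

  prepend-pred : ∀ k x a (G : ℕ → ℚ) → 1 ≤ k →
                 prepend k x (λ n → ℕ→ℚ n * G n) a ≡ prepend (pred k) x G a
  prepend-pred k x a G 1≤k = cong (B x a *_) (Σ-cong a N (λ n a<n _ →
    trans (regroup (weight k n) (1ℚ ÷ B x n) (ℕ→ℚ n) (G n))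
          (cong (λ w → w * (1ℚ ÷ B x n) * G n) (weight-pred k n 1≤k (ℕₚ.≤-trans (s≤s z≤n) a<n)))))
    where
    regroup : ∀ w i m g → w * i * (m * g) ≡ w * m * i * g
    regroup = solve-∀ ringℚ

  prepend-affine : ∀ k x a α (G : ℕ → ℚ) → 1 ≤ k →
                   prepend k x (λ n → (α - ℕ→ℚ n) * G n) a ≡ α * prepend k x G a - prepend (pred k) x G a
  prepend-affine k x a α G 1≤k = begin
    prepend k x (λ n → (α - ℕ→ℚ n) * G n) a
      ≡⟨ prepend-cong k x a (λ n _ _ → split α (ℕ→ℚ n) (G n)) ⟩
    prepend k x (λ n → α * G n + (- 1ℚ) * (ℕ→ℚ n * G n)) a
      ≡⟨ prepend-lin k x a α (- 1ℚ) G _ ⟩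
    α * prepend k x G a + (- 1ℚ) * prepend k x (λ n → ℕ→ℚ n * G n) a
      ≡⟨ cong (λ p → α * prepend k x G a + (- 1ℚ) * p) (prepend-pred k x a G 1≤k) ⟩
    α * prepend k x G a + (- 1ℚ) * prepend (pred k) x G a
      ≡⟨ unsplit α _ _ ⟩
    α * prepend k x G a - prepend (pred k) x G a
      ∎
    where
    open ≡-Reasoning
    split : ∀ α m g → (α - m) * g ≡ α * g + (- 1ℚ) * (m * g)
    split = solve-∀ ringℚ
    unsplit : ∀ α p q → α * p + (- 1ℚ) * q ≡ α * p - q
    unsplit = solve-∀ ringℚ

  prepend-if : ∀ k x a b (G : ℕ → ℚ) →
               prepend k x (λ n → if b then G n else 0ℚ) a ≡ (if b then prepend k x G a else 0ℚ)
  prepend-if k x a true  G = refl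
  prepend-if k x a false G = begin
    prepend k x (λ _ → 0ℚ) a             ≡⟨ prepend-cong k x a (λ _ _ _ → *-zeroˡ 0ℚ) ⟨
    prepend k x (λ _ → 0ℚ * 0ℚ) a        ≡⟨ prepend-* k x a 0ℚ (λ _ → 0ℚ) ⟩
    0ℚ * prepend k x (λ _ → 0ℚ) a        ≡⟨ *-zeroˡ (prepend k x (λ _ → 0ℚ) a) ⟩
    0ℚ                                   ∎
    where open ≡-Reasoning

  W-∷∷ : ∀ a k₁ k₂ κ x₁ x₂ y →
         W a (k₁ ∷ k₂ ∷ κ) (x₁ ∷ x₂ ∷ y) ≡ prepend k₁ x₁ (λ m → prepend k₂ x₂ (λ n → W n κ y) m) a
  W-∷∷ a k₁ k₂ κ x₁ x₂ y =
    trans (W-∷ a k₁ (k₂ ∷ κ) x₁ (x₂ ∷ y)) (prepend-cong k₁ x₁ a (λ m _ _ → W-∷ m k₂ κ x₂ y))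

  1÷B-shift : ∀ {v} → Generic v → ∀ n → n < N →
              (V v - ℕ→ℚ n) * (1ℚ ÷ B v n) ≡ V v * (1ℚ ÷ B (v + δ) n)
  1÷B-shift {v} Gv n n<N = ÷-cross (V v - ℕ→ℚ n) (V v) (B-≢0 Gv n n<N) (B-shift-≢0 Gv n n<N)
    (trans (*-comm (V v - ℕ→ℚ n) (B (v + δ) n)) (B-shift v n))

  prepend-shift : ∀ k v a (G : ℕ → ℚ) → Generic v →
                  prepend k v (λ n → (V v - ℕ→ℚ n) * G n) a ≡ (V v - ℕ→ℚ a) * prepend k (v + δ) G a
  prepend-shift k v a G Gv = begin
    B v a * Σ[ a < n < N ] (weight k n * (1ℚ ÷ B v n) * ((V v - ℕ→ℚ n) * G n))
      ≡⟨ cong (B v a *_) (Σ-cong a N (λ n _ n<N → summand n n<N)) ⟩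
    B v a * Σ[ a < n < N ] (V v * (weight k n * (1ℚ ÷ B v′ n) * G n))
      ≡⟨ cong (B v a *_) (*-Σ a N (V v) _) ⟨
    B v a * (V v * S)
      ≡⟨ regroup (B v a) (V v) S ⟩
    V v * B v a * S
      ≡⟨ cong (_* S) (B-shift v a) ⟨
    B v′ a * (V v - ℕ→ℚ a) * S
      ≡⟨ regroup′ (B v′ a) (V v - ℕ→ℚ a) S ⟩
    (V v - ℕ→ℚ a) * prepend k v′ G a
      ∎
    where
    open ≡-Reasoning
    v′ = v + δ
    S = Σ[ a < n < N ] (weight k n * (1ℚ ÷ B v′ n) * G n)
    regroup : ∀ b c s → b * (c * s) ≡ c * b * s
    regroup = solve-∀ ringℚ
    regroup′ : ∀ b c s → b * c * s ≡ c * (b * s)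
    regroup′ = solve-∀ ringℚ
    move : ∀ w i c g → w * i * (c * g) ≡ w * (c * i) * g
    move = solve-∀ ringℚ
    move′ : ∀ w c i g → w * (c * i) * g ≡ c * (w * i * g)
    move′ = solve-∀ ringℚ
    summand : ∀ n → n < N → weight k n * (1ℚ ÷ B v n) * ((V v - ℕ→ℚ n) * G n)
                          ≡ V v * (weight k n * (1ℚ ÷ B v′ n) * G n)
    summand n n<N = begin
      weight k n * (1ℚ ÷ B v n) * ((V v - ℕ→ℚ n) * G n)    ≡⟨ move (weight k n) (1ℚ ÷ B v n) (V v - ℕ→ℚ n) (G n) ⟩
      weight k n * ((V v - ℕ→ℚ n) * (1ℚ ÷ B v n)) * G n    ≡⟨ cong (λ r → weight k n * r * G n) (1÷B-shift Gv n n<N) ⟩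
      weight k n * (V v * (1ℚ ÷ B v′ n)) * G n             ≡⟨ move′ (weight k n) (V v) (1ℚ ÷ B v′ n) (G n) ⟩
      V v * (weight k n * (1ℚ ÷ B v′ n) * G n)             ∎

  prepend-shift-pred : ∀ k v a (G : ℕ → ℚ) → 1 ≤ k → Generic v →
    (V v - ℕ→ℚ a) * prepend k (v + δ) G a ≡ V v * prepend k v G a - prepend (pred k) v G a
  prepend-shift-pred k v a G 1≤k Gv =
    trans (sym (prepend-shift k v a G Gv)) (prepend-affine k v a (V v) G 1≤k)

  prepend-Δ : ∀ k v m (G : ℕ → ℚ) → 1 ≤ k → Generic v →
    Nq * (prepend k (v + δ) G m - prepend k v G m)
      ≡ (1ℚ ÷ v) * (ℕ→ℚ m * prepend k (v + δ) G m - prepend (pred k) v G m)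
  prepend-Δ k v m G 1≤k Gv =
    modulo (certificate Nq v (1ℚ ÷ v) (ℕ→ℚ m) P′ P Q)
           (vanish (1ℚ ÷ v) (prepend-shift-pred k v m G 1≤k Gv)
             +₀ vanish (- (Nq * (P′ - P))) (÷-inverseʳ (generic-≢0 Gv)))
    where
    P′ = prepend k (v + δ) G m
    P  = prepend k v G m
    Q  = prepend (pred k) v G m
    certificate : ∀ n v i m P′ P Q →
      n * (P′ - P) ≡ i * (m * P′ - Q)
        + (i * (((n * v - 1ℚ) + 1ℚ - m) * P′ - (((n * v - 1ℚ) + 1ℚ) * P - Q))
          + (- (n * (P′ - P))) * (v * i - 1ℚ))
    certificate = solve-∀ ringℚ

  W-Δ₂ : ∀ a kp ki κ xp xi y → 1 ≤ kp → 1 ≤ ki → Generic xi →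
    Nq * (W a (kp ∷ ki ∷ κ) (xp ∷ (xi + δ) ∷ y) - W a (kp ∷ ki ∷ κ) (xp ∷ xi ∷ y))
      ≡ (1ℚ ÷ xi) * (W a (pred kp ∷ ki ∷ κ) (xp ∷ (xi + δ) ∷ y) - W a (kp ∷ pred ki ∷ κ) (xp ∷ xi ∷ y))
  W-Δ₂ a kp ki κ xp xi y 1≤kp 1≤ki Gi = begin
    Nq * (W a (kp ∷ ki ∷ κ) (xp ∷ xi′ ∷ y) - W a (kp ∷ ki ∷ κ) (xp ∷ xi ∷ y))
      ≡⟨ cong₂ (λ p q → Nq * (p - q)) (W-∷∷ a kp ki κ xp xi′ y) (W-∷∷ a kp ki κ xp xi y) ⟩
    Nq * (prepend kp xp (P′ ki) a - prepend kp xp (P ki) a)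
      ≡⟨ prepend-*-− kp xp a Nq (P′ ki) (P ki) ⟨
    prepend kp xp (λ m → Nq * (P′ ki m - P ki m)) a
      ≡⟨ prepend-cong kp xp a (λ m _ _ → prepend-Δ ki xi m G 1≤ki Gi) ⟩
    prepend kp xp (λ m → (1ℚ ÷ xi) * (ℕ→ℚ m * P′ ki m - P (pred ki) m)) a
      ≡⟨ prepend-*-− kp xp a (1ℚ ÷ xi) _ _ ⟩
    (1ℚ ÷ xi) * (prepend kp xp (λ m → ℕ→ℚ m * P′ ki m) a - prepend kp xp (P (pred ki)) a)
      ≡⟨ cong (λ p → (1ℚ ÷ xi) * (p - prepend kp xp (P (pred ki)) a)) (prepend-pred kp xp a (P′ ki) 1≤kp) ⟩
    (1ℚ ÷ xi) * (prepend (pred kp) xp (P′ ki) a - prepend kp xp (P (pred ki)) a)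
      ≡⟨ cong₂ (λ p q → (1ℚ ÷ xi) * (p - q)) (W-∷∷ a (pred kp) ki κ xp xi′ y) (W-∷∷ a kp (pred ki) κ xp xi y) ⟨
    (1ℚ ÷ xi) * (W a (pred kp ∷ ki ∷ κ) (xp ∷ xi′ ∷ y) - W a (kp ∷ pred ki ∷ κ) (xp ∷ xi ∷ y))
      ∎
    where
    open ≡-Reasoning
    xi′ = xi + δ
    G : ℕ → ℚ
    G n = W n κ y
    P′ P : ℕ → ℕ → ℚ
    P′ k m = prepend k xi′ G m
    P  k m = prepend k xi G m

  W-shift₁ : ∀ a k κ v y → 1 ≤ k → Generic v →
    (V v - ℕ→ℚ a) * W a (k ∷ κ) ((v + δ) ∷ y) ≡ V v * W a (k ∷ κ) (v ∷ y) - W a (pred k ∷ κ) (v ∷ y)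
  W-shift₁ a k κ v y 1≤k Gv = begin
    (V v - ℕ→ℚ a) * W a (k ∷ κ) ((v + δ) ∷ y)
      ≡⟨ cong ((V v - ℕ→ℚ a) *_) (W-∷ a k κ (v + δ) y) ⟩
    (V v - ℕ→ℚ a) * prepend k (v + δ) G a
      ≡⟨ prepend-shift-pred k v a G 1≤k Gv ⟩
    V v * prepend k v G a - prepend (pred k) v G a
      ≡⟨ cong₂ (λ p q → V v * p - q) (W-∷ a k κ v y) (W-∷ a (pred k) κ v y) ⟨
    V v * W a (k ∷ κ) (v ∷ y) - W a (pred k ∷ κ) (v ∷ y)
      ∎
    where
    open ≡-Reasoning
    G : ℕ → ℚ
    G n = W n κ y

  -- Summing out a variable with index 0
  --
  -- The partial sums of binom(Az, m) / B v m telescope: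
  --   (Az - A v - 1) Σ_{a<m<n} ratio m  =  F n - F (a + 1).
  module Telescope (v Az : ℚ) where

    ratio : ℕ → ℚ
    ratio m = binom Az m * (1ℚ ÷ B v m)

    F : ℕ → ℚ
    F m = (V v - ℕ→ℚ m) * ratio m

    Side : ℕ → Set
    Side m = B v (suc m) ≢ 0ℚ ⊎ Az ≡ ℕ→ℚ m

    ratio-suc : ∀ m → Side m → (A v - ℕ→ℚ m) * ratio (suc m) ≡ (Az - ℕ→ℚ m) * ratio m
    ratio-suc m (inj₁ bv₁≢0) = begin
      (A v - ℕ→ℚ m) * (bz₁ * (1ℚ ÷ bv₁))   ≡⟨ *-assoc (A v - ℕ→ℚ m) bz₁ (1ℚ ÷ bv₁) ⟨
      (A v - ℕ→ℚ m) * bz₁ * (1ℚ ÷ bv₁)     ≡⟨ ÷-cross ((A v - ℕ→ℚ m) * bz₁) ((Az - ℕ→ℚ m) * bz₀) bv₁≢0 bv₀≢0 cross ⟩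
      (Az - ℕ→ℚ m) * bz₀ * (1ℚ ÷ bv₀)      ≡⟨ *-assoc (Az - ℕ→ℚ m) bz₀ (1ℚ ÷ bv₀) ⟩
      (Az - ℕ→ℚ m) * (bz₀ * (1ℚ ÷ bv₀))    ∎
      where
      open ≡-Reasoning
      bz₀ = binom Az m
      bz₁ = binom Az (suc m)
      bv₀ = B v m
      bv₁ = B v (suc m)
      m₁ = ℕ→ℚ (suc m)
      bv₀≢0 : bv₀ ≢ 0ℚ
      bv₀≢0 bv₀≡0 = bv₁≢0 (*-cancelʳ-≡ m₁ (ℕ→ℚ-suc-≢0 m)
        (trans (binom-suc (A v) m) (trans (cong (_* (A v - ℕ→ℚ m)) bv₀≡0)
          (trans (*-zeroˡ (A v - ℕ→ℚ m)) (sym (*-zeroˡ m₁))))))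
      certificate : ∀ a z m m₁ bz₀ bz₁ bv₀ bv₁ →
        (a - m) * bz₁ * bv₀ * m₁ ≡ (z - m) * bz₀ * bv₁ * m₁
          + ((a - m) * bv₀ * (bz₁ * m₁ - bz₀ * (z - m)) + (- ((z - m) * bz₀)) * (bv₁ * m₁ - bv₀ * (a - m)))
      certificate = solve-∀ ringℚ
      cross : (A v - ℕ→ℚ m) * bz₁ * bv₀ ≡ (Az - ℕ→ℚ m) * bz₀ * bv₁
      cross = *-cancelʳ-≡ m₁ (ℕ→ℚ-suc-≢0 m)
        (modulo (certificate (A v) Az (ℕ→ℚ m) m₁ bz₀ bz₁ bv₀ bv₁)
                (vanish ((A v - ℕ→ℚ m) * bv₀) (binom-suc Az m) +₀ vanish (- ((Az - ℕ→ℚ m) * bz₀)) (binom-suc (A v) m)))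
    ratio-suc m (inj₂ Az≡m) = begin
      (A v - ℕ→ℚ m) * (binom Az (suc m) * (1ℚ ÷ B v (suc m)))
        ≡⟨ cong (λ b → (A v - ℕ→ℚ m) * (b * (1ℚ ÷ B v (suc m)))) (binom-≡0 Az (suc m) m ℕₚ.≤-refl Az≡m) ⟩
      (A v - ℕ→ℚ m) * (0ℚ * (1ℚ ÷ B v (suc m)))
        ≡⟨ annihilate (A v - ℕ→ℚ m) (1ℚ ÷ B v (suc m)) (ratio m) ⟩
      0ℚ * ratio m
        ≡⟨ cong (_* ratio m) (p≡q⇒p-q≡0 Az≡m) ⟨
      (Az - ℕ→ℚ m) * ratio m
        ∎
      where
      open ≡-Reasoning
      annihilate : ∀ c i r → c * (0ℚ * i) ≡ 0ℚ * r
      annihilate = solve-∀ ringℚ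

    F-suc : ∀ m → F (suc m) ≡ (A v - ℕ→ℚ m) * ratio (suc m)
    F-suc m = trans (cong (λ t → (V v - t) * ratio (suc m)) (ℕ→ℚ-suc m)) (cancel (A v) (ℕ→ℚ m) (ratio (suc m)))
      where
      cancel : ∀ a m r → ((a + 1ℚ) - (m + 1ℚ)) * r ≡ (a - m) * r
      cancel = solve-∀ ringℚ

    F-step : ∀ m → Side m → ratio m * (Az - A v - 1ℚ) ≡ F (suc m) - F m
    F-step m side = begin
      ratio m * (Az - A v - 1ℚ)              ≡⟨ split (ratio m) Az (A v) (ℕ→ℚ m) ⟩
      (Az - ℕ→ℚ m) * ratio m - F m           ≡⟨ cong (_- F m) (ratio-suc m side) ⟨
      (A v - ℕ→ℚ m) * ratio (suc m) - F m    ≡⟨ cong (_- F m) (F-suc m) ⟨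
      F (suc m) - F m                        ∎
      where
      open ≡-Reasoning
      split : ∀ r z a m → r * (z - a - 1ℚ) ≡ (z - m) * r - ((a + 1ℚ) - m) * r
      split = solve-∀ ringℚ

    Σ-ratio : ∀ a n → a < n → (∀ m → a < m → m < n → Side m) →
              (Az - A v - 1ℚ) * Σ[ a < m < n ] ratio m ≡ F n - F (suc a)
    Σ-ratio a n a<n side = trans (*-Σ a n (Az - A v - 1ℚ) ratio)
      (Σ-telescope a n (λ m → (Az - A v - 1ℚ) * ratio m) F a<n (λ m a<m m<n →
        trans (*-comm (Az - A v - 1ℚ) (ratio m)) (F-step m (side m a<m m<n))))

    B-*-F-suc : ∀ a → B v a ≢ 0ℚ → Side a → B v a * F (suc a) ≡ (Az - ℕ→ℚ a) * binom Az a
    B-*-F-suc a bv≢0 side = begin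
      B v a * F (suc a)                                   ≡⟨ cong (B v a *_) (trans (F-suc a) (ratio-suc a side)) ⟩
      B v a * ((Az - ℕ→ℚ a) * (binom Az a * (1ℚ ÷ B v a))) ≡⟨ regroup (B v a) (Az - ℕ→ℚ a) (binom Az a) (1ℚ ÷ B v a) ⟩
      (Az - ℕ→ℚ a) * binom Az a * (B v a * (1ℚ ÷ B v a))  ≡⟨ cong ((Az - ℕ→ℚ a) * binom Az a *_) (÷-inverseʳ bv≢0) ⟩
      (Az - ℕ→ℚ a) * binom Az a * 1ℚ                      ≡⟨ *-identityʳ ((Az - ℕ→ℚ a) * binom Az a) ⟩
      (Az - ℕ→ℚ a) * binom Az a                           ∎
      where
      open ≡-Reasoning
      regroup : ∀ b c z i → b * (c * (z * i)) ≡ c * z * (b * i)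
      regroup = solve-∀ ringℚ

  prepend₀-prepend : ∀ a v z k (G : ℕ → ℚ) →
    prepend 0 v (λ m → prepend k z G m) a
      ≡ B v a * Σ[ a < n < N ] (weight k n * (1ℚ ÷ B z n) * G n * Σ[ a < m < n ] Telescope.ratio v (A z) m)
  prepend₀-prepend a v z k G = cong (B v a *_) (begin
    Σ[ a < m < N ] (weight 0 m * (1ℚ ÷ B v m) * (B z m * Σ[ m < n < N ] φ n))
      ≡⟨ Σ-cong a N (λ m _ _ → trans (regroup (1ℚ ÷ B v m) (B z m) (Σ[ m < n < N ] φ n))
                                     (*-Σ m N (ratio m) φ)) ⟩
    Σ[ a < m < N ] Σ[ m < n < N ] (ratio m * φ n)
      ≡⟨ Σ-swap a N (λ m n → ratio m * φ n) ⟩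
    Σ[ a < n < N ] Σ[ a < m < n ] (ratio m * φ n)
      ≡⟨ Σ-cong a N (λ n _ _ → trans (Σ-cong a n (λ m _ _ → *-comm (ratio m) (φ n)))
                                     (sym (*-Σ a n (φ n) ratio))) ⟩
    Σ[ a < n < N ] (φ n * Σ[ a < m < n ] ratio m)
      ∎)
    where
    open ≡-Reasoning
    open Telescope v (A z)
    φ : ℕ → ℚ
    φ n = weight k n * (1ℚ ÷ B z n) * G n
    regroup : ∀ i b s → 1ℚ * i * (b * s) ≡ b * i * s
    regroup = solve-∀ ringℚ

  prepend-sum-out : ∀ a v z k (G : ℕ → ℚ) → Generic v → (∀ n → n < N → B z n ≢ 0ℚ) →
    prepend 0 v (λ m → prepend k z G m) a * (A z - A v - 1ℚ)
      ≡ (V v - ℕ→ℚ a) * prepend k (v + δ) G a - (A z - ℕ→ℚ a) * prepend k z G a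
  prepend-sum-out a v z k G Gv Bz≢0 = begin
    prepend 0 v (λ m → prepend k z G m) a * K
      ≡⟨ cong (_* K) (prepend₀-prepend a v z k G) ⟩
    B v a * Σ[ a < n < N ] (φ n * Σ[ a < m < n ] ratio m) * K
      ≡⟨ regroup (B v a) (Σ[ a < n < N ] (φ n * Σ[ a < m < n ] ratio m)) K ⟩
    B v a * (K * Σ[ a < n < N ] (φ n * Σ[ a < m < n ] ratio m))
      ≡⟨ cong (B v a *_) (trans (*-Σ a N K (λ n → φ n * Σ[ a < m < n ] ratio m)) (Σ-cong a N telescoped)) ⟩
    B v a * Σ[ a < n < N ] (1ℚ * (φ n * F n) + (- F (suc a)) * φ n)
      ≡⟨ cong (B v a *_) (Σ-lin a N 1ℚ (- F (suc a)) (λ n → φ n * F n) φ) ⟩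
    B v a * (1ℚ * Σ[ a < n < N ] (φ n * F n) + (- F (suc a)) * Σ[ a < n < N ] φ n)
      ≡⟨ distribute (B v a) (Σ[ a < n < N ] (φ n * F n)) (F (suc a)) (Σ[ a < n < N ] φ n) ⟩
    B v a * Σ[ a < n < N ] (φ n * F n) - B v a * F (suc a) * Σ[ a < n < N ] φ n
      ≡⟨ cong₂ _-_ shifted boundary ⟩
    (V v - ℕ→ℚ a) * prepend k (v + δ) G a - (A z - ℕ→ℚ a) * prepend k z G a
      ∎
    where
    open ≡-Reasoning
    open Telescope v (A z)
    K = A z - A v - 1ℚ
    φ : ℕ → ℚ
    φ n = weight k n * (1ℚ ÷ B z n) * G n
    regroup : ∀ b s k → b * s * k ≡ b * (k * s)
    regroup = solve-∀ ringℚ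
    distribute : ∀ b s f t → b * (1ℚ * s + (- f) * t) ≡ b * s - b * f * t
    distribute = solve-∀ ringℚ
    telescoped : ∀ n → a < n → n < N →
                 K * (φ n * Σ[ a < m < n ] ratio m) ≡ 1ℚ * (φ n * F n) + (- F (suc a)) * φ n
    telescoped n a<n n<N = begin
      K * (φ n * Σ[ a < m < n ] ratio m)   ≡⟨ swap K (φ n) (Σ[ a < m < n ] ratio m) ⟩
      φ n * (K * Σ[ a < m < n ] ratio m)   ≡⟨ cong (φ n *_) (Σ-ratio a n a<n (λ m _ m<n →
                                                inj₁ (B-≢0 Gv (suc m) (ℕₚ.≤-<-trans m<n n<N)))) ⟩
      φ n * (F n - F (suc a))              ≡⟨ expand (φ n) (F n) (F (suc a)) ⟩
      1ℚ * (φ n * F n) + (- F (suc a)) * φ n ∎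
      where
      swap : ∀ k f s → k * (f * s) ≡ f * (k * s)
      swap = solve-∀ ringℚ
      expand : ∀ f x y → f * (x - y) ≡ 1ℚ * (f * x) + (- y) * f
      expand = solve-∀ ringℚ
    certificate : ∀ w iz g c bz iv →
      w * iz * g * (c * (bz * iv)) ≡ w * iv * (c * g) + (w * iv * c * g) * (bz * iz - 1ℚ)
    certificate = solve-∀ ringℚ
    shifted : B v a * Σ[ a < n < N ] (φ n * F n) ≡ (V v - ℕ→ℚ a) * prepend k (v + δ) G a
    shifted = trans (cong (B v a *_) (Σ-cong a N (λ n _ n<N →
        modulo (certificate (weight k n) (1ℚ ÷ B z n) (G n) (V v - ℕ→ℚ n) (B z n) (1ℚ ÷ B v n))
               (vanish (weight k n * (1ℚ ÷ B v n) * (V v - ℕ→ℚ n) * G n) (÷-inverseʳ (Bz≢0 n n<N))))))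
      (prepend-shift k v a G Gv)
    boundary : B v a * F (suc a) * Σ[ a < n < N ] φ n ≡ (A z - ℕ→ℚ a) * prepend k z G a
    boundary = trans (*-Σ-cong a N φ (λ 1+a<N →
        B-*-F-suc a (B-≢0 Gv a (ℕₚ.<-trans (ℕₚ.n<1+n a) 1+a<N)) (inj₁ (B-≢0 Gv (suc a) 1+a<N))))
      (*-assoc (A z - ℕ→ℚ a) (B z a) (Σ[ a < n < N ] φ n))

  prepend-sum-out-[]-< : ∀ a v → Generic v → a < N →
    prepend 0 v (λ m → W m [] []) a * (A 1ℚ - A v - 1ℚ) ≡ - ((A 1ℚ - ℕ→ℚ a) * W a [] [])
  prepend-sum-out-[]-< a v Gv a<N = begin
    B v a * Σ[ a < m < N ] (1ℚ * (1ℚ ÷ B v m) * (B 1ℚ m * 1ℚ)) * K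
      ≡⟨ cong (λ s → B v a * s * K) (Σ-cong a N (λ m _ _ → simplify (1ℚ ÷ B v m) (B 1ℚ m))) ⟩
    B v a * Σ[ a < m < N ] ratio m * K
      ≡⟨ regroup (B v a) (Σ[ a < m < N ] ratio m) K ⟩
    B v a * (K * Σ[ a < m < N ] ratio m)
      ≡⟨ cong (B v a *_) (Σ-ratio a N a<N (λ m _ m<N → side m m<N)) ⟩
    B v a * (F N - F (suc a))
      ≡⟨ cong (λ f → B v a * (f - F (suc a))) F-N ⟩
    B v a * (0ℚ - F (suc a))
      ≡⟨ negate (B v a) (F (suc a)) ⟩
    - (B v a * F (suc a))
      ≡⟨ cong -_ (B-*-F-suc a (B-≢0 Gv a a<N) (side a a<N)) ⟩
    - ((A 1ℚ - ℕ→ℚ a) * B 1ℚ a)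
      ≡⟨ cong (λ b → - ((A 1ℚ - ℕ→ℚ a) * b)) (*-identityʳ (B 1ℚ a)) ⟨
    - ((A 1ℚ - ℕ→ℚ a) * (B 1ℚ a * 1ℚ))
      ∎
    where
    open ≡-Reasoning
    open Telescope v (A 1ℚ)
    K = A 1ℚ - A v - 1ℚ
    simplify : ∀ i b → 1ℚ * i * (b * 1ℚ) ≡ b * i
    simplify = solve-∀ ringℚ
    regroup : ∀ b s k → b * s * k ≡ b * (k * s)
    regroup = solve-∀ ringℚ
    negate : ∀ b f → b * (0ℚ - f) ≡ - (b * f)
    negate = solve-∀ ringℚ
    -- The last step m = N - 1 is covered by A 1 = N - 1, as B v N may vanish.
    side : ∀ m → m < N → Side m
    side m m<N with ℕₚ.m<1+n⇒m<n∨m≡n (s≤s m<N)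
    ... | inj₁ 1+m<N = inj₁ (B-≢0 Gv (suc m) 1+m<N)
    ... | inj₂ 1+m≡N = inj₂ (trans A-1 (cong ℕ→ℚ (sym (ℕₚ.suc-injective 1+m≡N))))
    annihilate : ∀ c i → c * (0ℚ * i) ≡ 0ℚ
    annihilate = solve-∀ ringℚ
    F-N : F N ≡ 0ℚ
    F-N = trans (cong (λ b → (V v - ℕ→ℚ N) * (b * (1ℚ ÷ B v N))) (binom-≡0 (A 1ℚ) N N' ℕₚ.≤-refl A-1))
                (annihilate (V v - ℕ→ℚ N) (1ℚ ÷ B v N))

  prepend-sum-out-[]-≥ : ∀ a v → N ≤ a →
    prepend 0 v (λ m → W m [] []) a * (A 1ℚ - A v - 1ℚ) ≡ - ((A 1ℚ - ℕ→ℚ a) * W a [] [])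
  prepend-sum-out-[]-≥ a v N≤a = begin
    B v a * Σ[ a < m < N ] (1ℚ * (1ℚ ÷ B v m) * W m [] []) * K
      ≡⟨ cong (λ s → B v a * s * K) (Σ-empty a N (λ m → 1ℚ * (1ℚ ÷ B v m) * W m [] []) (ℕₚ.m≤n⇒m≤1+n N≤a)) ⟩
    B v a * 0ℚ * K
      ≡⟨ annihilate (B v a) K (A 1ℚ - ℕ→ℚ a) ⟩
    - ((A 1ℚ - ℕ→ℚ a) * (0ℚ * 1ℚ))
      ≡⟨ cong (λ b → - ((A 1ℚ - ℕ→ℚ a) * (b * 1ℚ))) (binom-≡0 (A 1ℚ) a N' N≤a A-1) ⟨
    - ((A 1ℚ - ℕ→ℚ a) * W a [] [])
      ∎
    where
    open ≡-Reasoning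
    K = A 1ℚ - A v - 1ℚ
    annihilate : ∀ b k c → b * 0ℚ * k ≡ - (c * (0ℚ * 1ℚ))
    annihilate = solve-∀ ringℚ

  prepend-sum-out-[] : ∀ a v → Generic v →
    prepend 0 v (λ m → W m [] []) a * (A 1ℚ - A v - 1ℚ) ≡ - ((A 1ℚ - ℕ→ℚ a) * W a [] [])
  prepend-sum-out-[] a v Gv =
    [ prepend-sum-out-[]-< a v Gv , prepend-sum-out-[]-≥ a v ]′ (ℕₚ.<-≤-connex a N)

  W-sum-out-∷ : ∀ a k κ v z y → Generic v → (∀ n → n < N → B z n ≢ 0ℚ) →
    W a (0 ∷ k ∷ κ) (v ∷ z ∷ y) * (A z - A v - 1ℚ)
      ≡ (V v - ℕ→ℚ a) * W a (k ∷ κ) ((v + δ) ∷ y) - (A z - ℕ→ℚ a) * W a (k ∷ κ) (z ∷ y)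
  W-sum-out-∷ a k κ v z y Gv Bz≢0 = begin
    W a (0 ∷ k ∷ κ) (v ∷ z ∷ y) * (A z - A v - 1ℚ)
      ≡⟨ cong (_* (A z - A v - 1ℚ)) (W-∷∷ a 0 k κ v z y) ⟩
    prepend 0 v (λ m → prepend k z G m) a * (A z - A v - 1ℚ)
      ≡⟨ prepend-sum-out a v z k G Gv Bz≢0 ⟩
    (V v - ℕ→ℚ a) * prepend k (v + δ) G a - (A z - ℕ→ℚ a) * prepend k z G a
      ≡⟨ cong₂ (λ p q → (V v - ℕ→ℚ a) * p - (A z - ℕ→ℚ a) * q) (W-∷ a k κ (v + δ) y) (W-∷ a k κ z y) ⟨
    (V v - ℕ→ℚ a) * W a (k ∷ κ) ((v + δ) ∷ y) - (A z - ℕ→ℚ a) * W a (k ∷ κ) (z ∷ y)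
      ∎
    where
    open ≡-Reasoning
    G : ℕ → ℚ
    G n = W n κ y

  -- For y = [] (that is, i = r) this boundary term is 0 by the paper's convention.
  W-next : ℕ → List ℕ → ℚ → List ℚ → ℚ
  W-next a κ v y = if 0 <ᵇ length y then W a κ ((v + δ) ∷ del y 1) else 0ℚ

  W-sum-out : ∀ a κ v y → length κ ≡ length y → Generic v →
    (T (0 <ᵇ length y) → Generic (nth 0ℚ y 1)) →
    W a (0 ∷ κ) (v ∷ y) * (A (nth 1ℚ y 1) - A v - 1ℚ)
      ≡ (V v - ℕ→ℚ a) * W-next a κ v y - (A (nth 1ℚ y 1) - ℕ→ℚ a) * W a κ y
  W-sum-out a [] v [] _ Gv _ = begin
    W a (0 ∷ []) (v ∷ []) * (A 1ℚ - A v - 1ℚ)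
      ≡⟨ cong (_* (A 1ℚ - A v - 1ℚ)) (W-∷ a 0 [] v []) ⟩
    prepend 0 v (λ m → W m [] []) a * (A 1ℚ - A v - 1ℚ)
      ≡⟨ prepend-sum-out-[] a v Gv ⟩
    - ((A 1ℚ - ℕ→ℚ a) * W a [] [])
      ≡⟨ pad (V v - ℕ→ℚ a) ((A 1ℚ - ℕ→ℚ a) * W a [] []) ⟩
    (V v - ℕ→ℚ a) * 0ℚ - (A 1ℚ - ℕ→ℚ a) * W a [] []
      ∎
    where
    open ≡-Reasoning
    pad : ∀ c w → - w ≡ c * 0ℚ - w
    pad = solve-∀ ringℚ
  W-sum-out a (k ∷ κ) v (z ∷ y) _ Gv Gz = W-sum-out-∷ a k κ v z y Gv (B-≢0 (Gz tt))
  W-sum-out a [] v (_ ∷ _) () _ _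
  W-sum-out a (_ ∷ _) v [] () _ _

  W-sum-out₂ : ∀ a kp κ xp xi y → 1 ≤ kp → length κ ≡ length y → Generic xi →
    (T (0 <ᵇ length y) → Generic (nth 0ℚ y 1)) →
    let z = nth 1ℚ y 1
        L = λ k → if 0 <ᵇ length y then W a (k ∷ κ) (xp ∷ (xi + δ) ∷ del y 1) else 0ℚ
        D = λ k → W a (k ∷ κ) (xp ∷ y)
    in W a (kp ∷ 0 ∷ κ) (xp ∷ xi ∷ y) * (A z - A xi - 1ℚ)
         ≡ (V xi * L kp - L (pred kp)) - (A z * D kp - D (pred kp))
  W-sum-out₂ a kp κ xp xi y 1≤kp len Gi Gz = begin
    W a (kp ∷ 0 ∷ κ) (xp ∷ xi ∷ y) * K
      ≡⟨ trans (cong (_* K) (W-∷ a kp (0 ∷ κ) xp (xi ∷ y))) (*-comm (prepend kp xp (λ m → W m (0 ∷ κ) (xi ∷ y)) a) K) ⟩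
    K * prepend kp xp (λ m → W m (0 ∷ κ) (xi ∷ y)) a
      ≡⟨ prepend-* kp xp a K (λ m → W m (0 ∷ κ) (xi ∷ y)) ⟨
    prepend kp xp (λ m → K * W m (0 ∷ κ) (xi ∷ y)) a
      ≡⟨ prepend-cong kp xp a (λ m _ _ → trans (*-comm K (W m (0 ∷ κ) (xi ∷ y))) (W-sum-out m κ xi y len Gi Gz)) ⟩
    prepend kp xp (λ m → (V xi - ℕ→ℚ m) * W-next m κ xi y - (A z - ℕ→ℚ m) * W m κ y) a
      ≡⟨ prepend-− kp xp a (λ m → (V xi - ℕ→ℚ m) * W-next m κ xi y) (λ m → (A z - ℕ→ℚ m) * W m κ y) ⟩
    prepend kp xp (λ m → (V xi - ℕ→ℚ m) * W-next m κ xi y) a - prepend kp xp (λ m → (A z - ℕ→ℚ m) * W m κ y) a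
      ≡⟨ cong₂ _-_ (prepend-affine kp xp a (V xi) (λ m → W-next m κ xi y) 1≤kp)
                   (prepend-affine kp xp a (A z) (λ m → W m κ y) 1≤kp) ⟩
    (V xi * Lp kp - Lp (pred kp)) - (A z * Dp kp - Dp (pred kp))
      ≡⟨ cong₂ (λ l l′ → (V xi * l - l′) - (A z * Dp kp - Dp (pred kp))) (prepend-next kp) (prepend-next (pred kp)) ⟩
    (V xi * L kp - L (pred kp)) - (A z * Dp kp - Dp (pred kp))
      ≡⟨ cong₂ (λ d d′ → (V xi * L kp - L (pred kp)) - (A z * d - d′))
               (W-∷ a kp κ xp y) (W-∷ a (pred kp) κ xp y) ⟨
    (V xi * L kp - L (pred kp)) - (A z * D kp - D (pred kp))
      ∎
    where
    open ≡-Reasoning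
    z = nth 1ℚ y 1
    K = A z - A xi - 1ℚ
    L : ℕ → ℚ
    L k = if 0 <ᵇ length y then W a (k ∷ κ) (xp ∷ (xi + δ) ∷ del y 1) else 0ℚ
    D : ℕ → ℚ
    D k = W a (k ∷ κ) (xp ∷ y)
    Lp Dp : ℕ → ℚ
    Lp k = prepend k xp (λ m → W-next m κ xi y) a
    Dp k = prepend k xp (λ m → W m κ y) a
    prepend-next : ∀ k → Lp k ≡ L k
    prepend-next k = trans (prepend-if k xp a (0 <ᵇ length y) (λ m → W m κ ((xi + δ) ∷ del y 1)))
      (cong (λ w → if 0 <ᵇ length y then w else 0ℚ) (sym (W-∷ a k κ xp ((xi + δ) ∷ del y 1))))

  W-sum-out-shifted : ∀ a k κ xp xi y → Generic xp → Generic xi →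
    W a (0 ∷ k ∷ κ) (xp ∷ (xi + δ) ∷ y) * (V xi - A xp - 1ℚ)
      ≡ (V xp - ℕ→ℚ a) * W a (k ∷ κ) ((xp + δ) ∷ y) - (V xi - ℕ→ℚ a) * W a (k ∷ κ) ((xi + δ) ∷ y)
  W-sum-out-shifted a k κ xp xi y Gp Gi =
    subst (λ u → W a (0 ∷ k ∷ κ) (xp ∷ (xi + δ) ∷ y) * (u - A xp - 1ℚ)
                   ≡ (V xp - ℕ→ℚ a) * W a (k ∷ κ) ((xp + δ) ∷ y) - (u - ℕ→ℚ a) * W a (k ∷ κ) ((xi + δ) ∷ y))
          (A-shift xi) (W-sum-out-∷ a k κ xp (xi + δ) y Gp (B-shift-≢0 Gi))

  W-sum-out₁ : ∀ a ki κ xp xi y → 1 ≤ ki → Generic xp → Generic xi →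
    W a (0 ∷ ki ∷ κ) (xp ∷ (xi + δ) ∷ y) * (V xi - A xp - 1ℚ)
      ≡ (V xp * W a (ki ∷ κ) (xp ∷ y) - W a (pred ki ∷ κ) (xp ∷ y))
        - (V xi * W a (ki ∷ κ) (xi ∷ y) - W a (pred ki ∷ κ) (xi ∷ y))
  W-sum-out₁ a ki κ xp xi y 1≤ki Gp Gi = begin
    W a (0 ∷ ki ∷ κ) (xp ∷ (xi + δ) ∷ y) * (V xi - A xp - 1ℚ)
      ≡⟨ W-sum-out-shifted a ki κ xp xi y Gp Gi ⟩
    (V xp - ℕ→ℚ a) * W a (ki ∷ κ) ((xp + δ) ∷ y) - (V xi - ℕ→ℚ a) * W a (ki ∷ κ) ((xi + δ) ∷ y)
      ≡⟨ cong₂ _-_ (W-shift₁ a ki κ xp y 1≤ki Gp) (W-shift₁ a ki κ xi y 1≤ki Gi) ⟩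
    (V xp * W a (ki ∷ κ) (xp ∷ y) - W a (pred ki ∷ κ) (xp ∷ y))
      - (V xi * W a (ki ∷ κ) (xi ∷ y) - W a (pred ki ∷ κ) (xi ∷ y))
      ∎
    where open ≡-Reasoning

  W-sum-out-cycle : ∀ a κ xp xi y → length κ ≡ length y → Generic xp → Generic xi →
    (T (0 <ᵇ length y) → Generic (nth 0ℚ y 1)) →
    let z  = nth 1ℚ y 1
        Ld = if 0 <ᵇ length y then W a (0 ∷ κ) (xp ∷ (xi + δ) ∷ del y 1) else 0ℚ
    in W a (0 ∷ κ) (xi ∷ y) * (A z - A xi - 1ℚ) - W a (0 ∷ κ) (xp ∷ y) * (A z - A xp - 1ℚ)
         + Ld * (V xi - A xp - 1ℚ) ≡ 0ℚ
  W-sum-out-cycle a κ xp xi y len Gp Gi Gz =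
    cycle ((V xi - ℕ→ℚ a) * W-next a κ xi y) ((V xp - ℕ→ℚ a) * W-next a κ xp y)
          ((A (nth 1ℚ y 1) - ℕ→ℚ a) * W a κ y)
          (W-sum-out a κ xi y len Gi Gz) (W-sum-out a κ xp y len Gp Gz) (boundary κ y len)
    where
    cycle : ∀ {u w l} p q r → u ≡ p - r → w ≡ q - r → l ≡ q - p → u - w + l ≡ 0ℚ
    cycle p q r refl refl refl = identity p q r
      where
      identity : ∀ p q r → p - r - (q - r) + (q - p) ≡ 0ℚ
      identity = solve-∀ ringℚ
    boundary : ∀ κ y → length κ ≡ length y →
      (if 0 <ᵇ length y then W a (0 ∷ κ) (xp ∷ (xi + δ) ∷ del y 1) else 0ℚ) * (V xi - A xp - 1ℚ)
        ≡ (V xp - ℕ→ℚ a) * W-next a κ xp y - (V xi - ℕ→ℚ a) * W-next a κ xi y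
    boundary [] [] _ = annihilate (V xi - A xp - 1ℚ) (V xp - ℕ→ℚ a) (V xi - ℕ→ℚ a)
      where
      annihilate : ∀ k c d → 0ℚ * k ≡ c * 0ℚ - d * 0ℚ
      annihilate = solve-∀ ringℚ
    boundary (k ∷ κ) (_ ∷ y) _ = W-sum-out-shifted a k κ xp xi y Gp Gi
    boundary [] (_ ∷ _) ()
    boundary (_ ∷ _) [] ()

  eval-prefix : ∀ a k x ts → eval (W a) (map (prefix k x) ts) ≡ prepend k x (λ n → eval (W n) ts) a
  eval-prefix a k x [] = sym (prepend-if k x a false (λ _ → 0ℚ))
  eval-prefix a k x (term c κ y b ∷ ts) = begin
    c * (if b then W a (k ∷ κ) (x ∷ y) else 0ℚ) + eval (W a) (map (prefix k x) ts)
      ≡⟨ cong₂ (λ p q → c * p + q) head (eval-prefix a k x ts) ⟩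
    c * prepend k x G a + prepend k x H a
      ≡⟨ cong (c * prepend k x G a +_) (*-identityˡ (prepend k x H a)) ⟨
    c * prepend k x G a + 1ℚ * prepend k x H a
      ≡⟨ prepend-lin k x a c 1ℚ G H ⟨
    prepend k x (λ n → c * G n + 1ℚ * H n) a
      ≡⟨ prepend-cong k x a (λ n _ _ → cong (c * G n +_) (*-identityˡ (H n))) ⟩
    prepend k x (λ n → c * G n + H n) a
      ∎
    where
    open ≡-Reasoning
    G H : ℕ → ℚ
    G n = if b then W n κ y else 0ℚ
    H n = eval (W n) ts
    head : (if b then W a (k ∷ κ) (x ∷ y) else 0ℚ) ≡ prepend k x G a
    head = trans (cong (λ w → if b then w else 0ℚ) (W-∷ a k κ x y)) (sym (prepend-if k x a b (λ n → W n κ y)))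

  Next : (List ℕ → List ℚ → ℚ) → List ℕ → List ℚ → ℕ → ℚ
  Next f κ x i = if i <ᵇ length x then f κ (shift N (del x (suc i)) i) else 0ℚ

  Lhs R₁ R₂ R₃ R₄ : List ℕ → List ℚ → ℕ → List Term
  Lhs k x i = term Nq k (shift N x i) true ∷ term (- Nq) k x true ∷ []
  R₁ k x i =
      term (1ℚ ÷ xi) (dec k (pred i)) (shift N x i) true
    ∷ term (- (1ℚ ÷ xi)) (dec k i) x true
    ∷ []
    where
    xi = nth 0ℚ x i
  R₂ k x i =
      term (1ℚ ÷ xi) (dec k (pred i)) (shift N x i) true
    ∷ term (1ℚ ÷ xi) (del k i) (del x i) true
    ∷ term (- ic) (del k i) (del x i) true
    ∷ term ic (del k i) (shift N (del x (suc i)) i) (i <ᵇ length x)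
    ∷ term (- (δ * icx)) (del (dec k (pred i)) i) (shift N (del x (suc i)) i) (i <ᵇ length x)
    ∷ term (δ * icx) (del (dec k (pred i)) i) (del x i) true
    ∷ []
    where
    xi = nth 0ℚ x i
    c = xi + δ - nth 1ℚ x (suc i)
    ic = 1ℚ ÷ c
    icx = 1ℚ ÷ (xi * c)
  R₃ k x i =
      term (- id) (del k (pred i)) (del x (pred i)) true
    ∷ term id (del k (pred i)) (del x i) true
    ∷ term (- (1ℚ ÷ xi)) (del k (pred i)) (del x i) true
    ∷ term (- (1ℚ ÷ xi)) (dec k i) x true
    ∷ term (- (δ * icp)) (del (dec k i) (pred i)) (del x i) true
    ∷ term (δ * icp) (del (dec k i) (pred i)) (del x (pred i)) true
    ∷ []
    where
    xi = nth 0ℚ x i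
    d = xi - nth 0ℚ x (pred i)
    id = 1ℚ ÷ d
    icp = 1ℚ ÷ (xi * d)
  R₄ k x i =
      term (- id) (del k (pred i)) (del x (pred i)) true
    ∷ term id (del k i) (del x i) true
    ∷ term (- ic) (del k i) (del x i) true
    ∷ term ic (del k i) (shift N (del x (suc i)) i) (i <ᵇ length x)
    ∷ []
    where
    xi = nth 0ℚ x i
    id = 1ℚ ÷ (xi - nth 0ℚ x (pred i))
    ic = 1ℚ ÷ (xi + δ - nth 1ℚ x (suc i))

  eval-Lhs : ∀ f k x i → eval f (Lhs k x i) ≡ Nq * (f k (shift N x i) - f k x)
  eval-Lhs f k x i = rearrange Nq (f k (shift N x i)) (f k x)
    where
    rearrange : ∀ c p q → c * p + ((- c) * q + 0ℚ) ≡ c * (p - q)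
    rearrange = solve-∀ ringℚ

  eval-R₁ : ∀ f k x i → let xi = nth 0ℚ x i in
    eval f (R₁ k x i) ≡ (1ℚ ÷ xi) * (f (dec k (pred i)) (shift N x i) - f (dec k i) x)
  eval-R₁ f k x i = rearrange (1ℚ ÷ nth 0ℚ x i) (f (dec k (pred i)) (shift N x i)) (f (dec k i) x)
    where
    rearrange : ∀ c p q → c * p + ((- c) * q + 0ℚ) ≡ c * (p - q)
    rearrange = solve-∀ ringℚ

  eval-R₂ : ∀ f k x i →
    let xi = nth 0ℚ x i
        xn = nth 1ℚ x (suc i)
        κ = del k i
        κ′ = del (dec k (pred i)) i
    in eval f (R₂ k x i)
         ≡ (1ℚ ÷ xi) * (f (dec k (pred i)) (shift N x i) + f κ (del x i))
           - (1ℚ ÷ (xi + δ - xn)) * (f κ (del x i) - Next f κ x i)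
           - δ * (1ℚ ÷ (xi * (xi + δ - xn))) * (Next f κ′ x i - f κ′ (del x i))
  eval-R₂ f k x i = rearrange (1ℚ ÷ xi) (1ℚ ÷ (xi + δ - xn)) (δ * (1ℚ ÷ (xi * (xi + δ - xn))))
    (f (dec k (pred i)) (shift N x i)) (f (del k i) (del x i)) (Next f (del k i) x i)
    (Next f (del (dec k (pred i)) i) x i) (f (del (dec k (pred i)) i) (del x i))
    where
    xi = nth 0ℚ x i
    xn = nth 1ℚ x (suc i)
    rearrange : ∀ c c′ c″ p q r s t →
      c * p + (c * q + ((- c′) * q + (c′ * r + ((- c″) * s + (c″ * t + 0ℚ)))))
        ≡ c * (p + q) - c′ * (q - r) - c″ * (s - t)
    rearrange = solve-∀ ringℚ

  eval-R₃ : ∀ f k x i →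
    let xi = nth 0ℚ x i
        xp = nth 0ℚ x (pred i)
        κ = del k (pred i)
        κ′ = del (dec k i) (pred i)
    in eval f (R₃ k x i)
         ≡ - (1ℚ ÷ (xi - xp)) * (f κ (del x (pred i)) - f κ (del x i))
           - (1ℚ ÷ xi) * (f κ (del x i) + f (dec k i) x)
           - δ * (1ℚ ÷ (xi * (xi - xp))) * (f κ′ (del x i) - f κ′ (del x (pred i)))
  eval-R₃ f k x i = rearrange (1ℚ ÷ (xi - xp)) (1ℚ ÷ xi) (δ * (1ℚ ÷ (xi * (xi - xp))))
    (f (del k (pred i)) (del x (pred i))) (f (del k (pred i)) (del x i)) (f (dec k i) x)
    (f (del (dec k i) (pred i)) (del x i)) (f (del (dec k i) (pred i)) (del x (pred i)))
    where
    xi = nth 0ℚ x i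
    xp = nth 0ℚ x (pred i)
    rearrange : ∀ c c′ c″ p q r s t →
      (- c) * p + (c * q + ((- c′) * q + ((- c′) * r + ((- c″) * s + (c″ * t + 0ℚ)))))
        ≡ - c * (p - q) - c′ * (q + r) - c″ * (s - t)
    rearrange = solve-∀ ringℚ

  eval-R₄ : ∀ f k x i →
    let xi = nth 0ℚ x i
        xp = nth 0ℚ x (pred i)
        xn = nth 1ℚ x (suc i)
    in eval f (R₄ k x i)
         ≡ - (1ℚ ÷ (xi - xp)) * (f (del k (pred i)) (del x (pred i)) - f (del k i) (del x i))
           - (1ℚ ÷ (xi + δ - xn)) * (f (del k i) (del x i) - Next f (del k i) x i)
  eval-R₄ f k x i = rearrange (1ℚ ÷ (xi - xp)) (1ℚ ÷ (xi + δ - xn))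
    (f (del k (pred i)) (del x (pred i))) (f (del k i) (del x i)) (Next f (del k i) x i)
    where
    xi = nth 0ℚ x i
    xp = nth 0ℚ x (pred i)
    xn = nth 1ℚ x (suc i)
    rearrange : ∀ c c′ p q r →
      (- c) * p + (c * q + ((- c′) * q + (c′ * r + 0ℚ))) ≡ - c * (p - q) - c′ * (q - r)
    rearrange = solve-∀ ringℚ

  _≋_ : List Term → List Term → Set
  ts ≋ us = ∀ a → eval (W a) ts ≡ eval (W a) us

  Local : (ℕ → ℕ → Set) → List ℕ → List ℚ → ℕ → Set
  Local P k x i =
    P (nth 0 k (pred i)) (nth 0 k i)
    × Generic (nth 0ℚ x (pred i)) × Generic (nth 0ℚ x i)
    × (T (i <ᵇ length x) → Generic (nth 0ℚ x (suc i)))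
    × nth 0ℚ x i ≢ nth 0ℚ x (pred i)
    × nth 0ℚ x i + δ ≢ nth 1ℚ x (suc i)

  Prefix-stable : (List ℕ → List ℚ → ℕ → List Term) → Set
  Prefix-stable R = ∀ k₁ x₁ k x j →
    R (k₁ ∷ k) (x₁ ∷ x) (suc (suc (suc j))) ≡ map (prefix k₁ x₁) (R k x (suc (suc j)))

  Base-case : (ℕ → ℕ → Set) → (List ℕ → List ℚ → ℕ → List Term) → Set
  Base-case P R = ∀ kp ki κ xp xi y → length κ ≡ length y → Local P (kp ∷ ki ∷ κ) (xp ∷ xi ∷ y) 2 →
    Lhs (kp ∷ ki ∷ κ) (xp ∷ xi ∷ y) 2 ≋ R (kp ∷ ki ∷ κ) (xp ∷ xi ∷ y) 2

  -- Prefixing all lists by (k₁, x₁) turns an identity at position i into the same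
  -- identity at position i + 1, so it suffices to prove it at i = 2.
  localise : ∀ R P → Prefix-stable R → Base-case P R →
    ∀ j k x → length k ≡ length x → suc (suc j) ≤ length k → Local P k x (suc (suc j)) →
    Lhs k x (suc (suc j)) ≋ R k x (suc (suc j))
  localise R P R-prefix base zero (kp ∷ ki ∷ κ) (xp ∷ xi ∷ y) len _ loc =
    base kp ki κ xp xi y (ℕₚ.suc-injective (ℕₚ.suc-injective len)) loc
  localise R P R-prefix base (suc j) (k₁ ∷ k) (x₁ ∷ x) len 3+j≤r loc a = begin
    eval (W a) (map (prefix k₁ x₁) (Lhs k x i))         ≡⟨ eval-prefix a k₁ x₁ (Lhs k x i) ⟩
    prepend k₁ x₁ (λ n → eval (W n) (Lhs k x i)) a      ≡⟨ prepend-cong k₁ x₁ a (λ n _ _ → induction n) ⟩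
    prepend k₁ x₁ (λ n → eval (W n) (R k x i)) a        ≡⟨ eval-prefix a k₁ x₁ (R k x i) ⟨
    eval (W a) (map (prefix k₁ x₁) (R k x i))           ≡⟨ cong (eval (W a)) (R-prefix k₁ x₁ k x j) ⟨
    eval (W a) (R (k₁ ∷ k) (x₁ ∷ x) (suc i))            ∎
    where
    open ≡-Reasoning
    i = suc (suc j)
    induction : Lhs k x i ≋ R k x i
    induction = localise R P R-prefix base j k x (ℕₚ.suc-injective len) (ℕₚ.≤-pred 3+j≤r) loc
  localise _ _ _ _ zero    []              _               _  ()       _
  localise _ _ _ _ zero    (_ ∷ [])        _               _  (s≤s ()) _
  localise _ _ _ _ zero    (_ ∷ _ ∷ _)     []              () _        _
  localise _ _ _ _ zero    (_ ∷ _ ∷ _)     (_ ∷ [])        () _        _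
  localise _ _ _ _ (suc j) []              _               _  ()       _
  localise _ _ _ _ (suc j) (_ ∷ _)         []              () _        _

  base₁ : Base-case Case₁ R₁
  base₁ kp ki κ xp xi y _ ((kp>1 , ki>1) , _ , Gi , _) a =
    trans (eval-Lhs (W a) (kp ∷ ki ∷ κ) (xp ∷ xi ∷ y) 2)
      (trans (W-Δ₂ a kp ki κ xp xi y (ℕₚ.<⇒≤ kp>1) (ℕₚ.<⇒≤ ki>1) Gi)
             (sym (eval-R₁ (W a) (kp ∷ ki ∷ κ) (xp ∷ xi ∷ y) 2)))

  base₂ : Base-case Case₂ R₂
  base₂ kp .1 κ xp xi y len ((kp>1 , refl) , _ , Gi , Gz , _ , xi+δ≢z) a =
    trans (eval-Lhs (W a) (kp ∷ 1 ∷ κ) (xp ∷ xi ∷ y) 2)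
      (trans (W-Δ₂ a kp 1 κ xp xi y 1≤kp ℕₚ.≤-refl Gi)
        (trans (combine₂ Nq δ xi (1ℚ ÷ xi) z (1ℚ ÷ c) (1ℚ ÷ (xi * c))
                  (W a (pred kp ∷ 1 ∷ κ) (xp ∷ (xi + δ) ∷ y)) (W a (kp ∷ 0 ∷ κ) (xp ∷ xi ∷ y))
                  (L kp) (L (pred kp)) (W a (kp ∷ κ) (xp ∷ y)) (W a (pred kp ∷ κ) (xp ∷ y))
                  (W-sum-out₂ a kp κ xp xi y 1≤kp len Gi Gz)
                  (÷-inverseʳ (generic-≢0 Gi)) Nq*δ≡1 (÷-inverseʳ (p-q≢0 xi+δ≢z)) (1÷-*-distrib xi c))
               (sym (eval-R₂ (W a) (kp ∷ 1 ∷ κ) (xp ∷ xi ∷ y) 2))))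
    where
    1≤kp = ℕₚ.<⇒≤ kp>1
    z = nth 1ℚ y 1
    c = xi + δ - z
    L : ℕ → ℚ
    L k = if 0 <ᵇ length y then W a (k ∷ κ) (xp ∷ (xi + δ) ∷ del y 1) else 0ℚ

  base₃ : Base-case Case₃ R₃
  base₃ .1 ki κ xp xi y _ ((refl , ki>1) , Gp , Gi , _ , xi≢xp , _) a =
    trans (eval-Lhs (W a) (1 ∷ ki ∷ κ) (xp ∷ xi ∷ y) 2)
      (trans (W-Δ₂ a 1 ki κ xp xi y ℕₚ.≤-refl 1≤ki Gi)
        (trans (combine₃ Nq δ xi (1ℚ ÷ xi) xp (1ℚ ÷ d) (1ℚ ÷ (xi * d))
                  (W a (0 ∷ ki ∷ κ) (xp ∷ (xi + δ) ∷ y)) (W a (1 ∷ pred ki ∷ κ) (xp ∷ xi ∷ y))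
                  (W a (ki ∷ κ) (xp ∷ y)) (W a (pred ki ∷ κ) (xp ∷ y))
                  (W a (ki ∷ κ) (xi ∷ y)) (W a (pred ki ∷ κ) (xi ∷ y))
                  (W-sum-out₁ a ki κ xp xi y 1≤ki Gp Gi)
                  (÷-inverseʳ (generic-≢0 Gi)) Nq*δ≡1 (÷-inverseʳ (p-q≢0 xi≢xp)) (1÷-*-distrib xi d))
               (sym (eval-R₃ (W a) (1 ∷ ki ∷ κ) (xp ∷ xi ∷ y) 2))))
    where
    1≤ki = ℕₚ.<⇒≤ ki>1
    d = xi - xp

  base₄ : Base-case Case₄ R₄
  base₄ .1 .1 κ xp xi y len ((refl , refl) , Gp , Gi , Gz , xi≢xp , xi+δ≢z) a =
    trans (eval-Lhs (W a) (1 ∷ 1 ∷ κ) (xp ∷ xi ∷ y) 2)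
      (trans (W-Δ₂ a 1 1 κ xp xi y ℕₚ.≤-refl ℕₚ.≤-refl Gi)
        (trans (combine₄ Nq δ xi (1ℚ ÷ xi) xp z (1ℚ ÷ (xi - xp)) (1ℚ ÷ (xi + δ - z))
                  (W a (0 ∷ 1 ∷ κ) (xp ∷ (xi + δ) ∷ y)) (W a (1 ∷ 0 ∷ κ) (xp ∷ xi ∷ y))
                  (W a (1 ∷ κ) (xi ∷ y)) (W a (1 ∷ κ) (xp ∷ y)) (L 1)
                  (W a (0 ∷ κ) (xi ∷ y)) (W a (0 ∷ κ) (xp ∷ y)) (L 0)
                  (W-sum-out₂ a 1 κ xp xi y ℕₚ.≤-refl len Gi Gz)
                  (W-sum-out₁ a 1 κ xp xi y ℕₚ.≤-refl Gp Gi)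
                  (W-sum-out-cycle a κ xp xi y len Gp Gi Gz)
                  (÷-inverseʳ (generic-≢0 Gi)) Nq*δ≡1 (÷-inverseʳ (p-q≢0 xi+δ≢z)) (÷-inverseʳ (p-q≢0 xi≢xp)))
               (sym (eval-R₄ (W a) (1 ∷ 1 ∷ κ) (xp ∷ xi ∷ y) 2))))
    where
    z = nth 1ℚ y 1
    L : ℕ → ℚ
    L k = if 0 <ᵇ length y then W a (k ∷ κ) (xp ∷ (xi + δ) ∷ del y 1) else 0ℚ

  identity-at : ∀ R P → Prefix-stable R → Base-case P R →
    ∀ j k x → length k ≡ length x → suc (suc j) ≤ length k → Local P k x (suc (suc j)) →
    ΔLi N k x (suc (suc j)) ≡ eval (Li N) (R k x (suc (suc j)))
  identity-at R P R-prefix base j k x len i≤r loc = begin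
    ΔLi N k x i                 ≡⟨ eval-Lhs (Li N) k x i ⟨
    eval (Li N) (Lhs k x i)     ≡⟨ eval-cong Li≡W0 (Lhs k x i) ⟩
    eval (W 0) (Lhs k x i)      ≡⟨ localise R P R-prefix base j k x len i≤r loc 0 ⟩
    eval (W 0) (R k x i)        ≡⟨ eval-cong Li≡W0 (R k x i) ⟨
    eval (Li N) (R k x i)       ∎
    where
    open ≡-Reasoning
    i = suc (suc j)

theorem3p2 : (N : ℕ) → 1 ≤ N → (k : List ℕ) → (x : List ℚ) →
    length k ≡ length x → All (1 ≤_) k → 1 < length k →
    (i : ℕ) → 1 < i → i ≤ length k →
    -- genericity of the indeterminates: all denominators are nonzero
    (∀ j m → 1 ≤ j → j ≤ length k → m < N → ℕ→ℚ N * nth 0ℚ x j ≢ ℕ→ℚ m) →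
    nth 0ℚ x i ≢ nth 0ℚ x (pred i) →
    nth 0ℚ x i + 1ℚ ÷ ℕ→ℚ N ≢ nth 1ℚ x (suc i) →
    let xi = nth 0ℚ x i
        xp = nth 0ℚ x (pred i)
        xn = nth 1ℚ x (suc i)
        ki = nth 0 k i
        kp = nth 0 k (pred i)
        iN = 1ℚ ÷ ℕ→ℚ N
    in
    (kp > 1 → ki > 1 →
      ΔLi N k x i ≡
        (1ℚ ÷ xi) * (Li N (dec k (pred i)) (shift N x i) - Li N (dec k i) x))
    ×
    (kp > 1 → ki ≡ 1 →
      ΔLi N k x i ≡
        (1ℚ ÷ xi) * (Li N (dec k (pred i)) (shift N x i) + Li N (del k i) (del x i))
        - (1ℚ ÷ (xi + iN - xn)) * (Li N (del k i) (del x i) - LiNext N (del k i) x i)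
        - iN * (1ℚ ÷ (xi * (xi + iN - xn)))
            * (LiNext N (del (dec k (pred i)) i) x i
               - Li N (del (dec k (pred i)) i) (del x i)))
    ×
    (kp ≡ 1 → ki > 1 →
      ΔLi N k x i ≡
        - (1ℚ ÷ (xi - xp)) * (Li N (del k (pred i)) (del x (pred i))
                              - Li N (del k (pred i)) (del x i))
        - (1ℚ ÷ xi) * (Li N (del k (pred i)) (del x i) + Li N (dec k i) x)
        - iN * (1ℚ ÷ (xi * (xi - xp)))
            * (Li N (del (dec k i) (pred i)) (del x i)
               - Li N (del (dec k i) (pred i)) (del x (pred i))))
    ×
    (kp ≡ 1 → ki ≡ 1 →
      ΔLi N k x i ≡
        - (1ℚ ÷ (xi - xp)) * (Li N (del k (pred i)) (del x (pred i))
                              - Li N (del k i) (del x i))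
        - (1ℚ ÷ (xi + iN - xn)) * (Li N (del k i) (del x i) - LiNext N (del k i) x i))
-- The identities are local to positions i - 1, i, i + 1: the positivity of the
-- other indices and the bound 1 < r are not needed.
theorem3p2 (suc N') (s≤s z≤n) k x len _ _ (suc (suc j)) (s≤s (s≤s z≤n)) i≤r generic xi≢xp xi+δ≢xn =
    (λ kp>1 ki>1 → trans (at (R₁ N') (λ _ _ _ _ _ → refl) (base₁ N') (kp>1 , ki>1)) (eval-R₁ N' (Li N) k x i))
  , (λ kp>1 ki≡1 → trans (at (R₂ N') (λ _ _ _ _ _ → refl) (base₂ N') (kp>1 , ki≡1)) (eval-R₂ N' (Li N) k x i))
  , (λ kp≡1 ki>1 → trans (at (R₃ N') (λ _ _ _ _ _ → refl) (base₃ N') (kp≡1 , ki>1)) (eval-R₃ N' (Li N) k x i))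
  , (λ kp≡1 ki≡1 → trans (at (R₄ N') (λ _ _ _ _ _ → refl) (base₄ N') (kp≡1 , ki≡1)) (eval-R₄ N' (Li N) k x i))
  where
  N = suc N'
  i = suc (suc j)
  generic-at : ∀ j → 1 ≤ j → j ≤ length k → Generic N' (nth 0ℚ x j)
  generic-at j 1≤j j≤r m m<N = generic j m 1≤j j≤r m<N
  at : ∀ R {P} → Prefix-stable N' R → Base-case N' P R → P (nth 0 k (pred i)) (nth 0 k i) →
       ΔLi N k x i ≡ eval (Li N) (R k x i)
  at R {P} R-prefix base p = identity-at N' R P R-prefix base j k x len i≤r
    ( p
    , generic-at (pred i) (s≤s z≤n) (ℕₚ.≤-trans (ℕₚ.n≤1+n (pred i)) i≤r)
    , generic-at i (s≤s z≤n) i≤r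
    , (λ i<r → generic-at (suc i) (s≤s z≤n) (subst (suc i ≤_) (sym len) (ℕₚ.<ᵇ⇒< i (length x) i<r)))
    , xi≢xp
    , xi+δ≢xn )
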